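{- Let $p$ be an odd prime, $\alpha\geqslant1$, and $X\subseteq\mathbb{Z}_{p^\alpha}$ satisfy: $0\notin X$, $X\neq-X$, and there is a positive integer $m$ with $(\mathcal{F}\Delta_{U_X})(z)\in\{0,-m\}$ for all $0\neq z$, where $U_X=X\uplus(-X)$. Let $\Gamma=\{z:(\mathcal{F}\Delta_{U_X})(z)=-m\}$ and $\beta=\min\{\nu_p(z):z\in\Gamma\}$. Then no element of $\mathbb{Z}_{p^\alpha}$ has multiplicity $2$ in $U_X$ (i.e. $\mathcal{I}_1=\emptyset$, where $\mathcal{I}_1$ is the set of $r$ such that $O_r$ occurs with multiplicity $2$ in $U_X$), and $U_X=\mathbb{Z}_{p^\alpha}\setminus p^{\alpha-\beta}\mathbb{Z}_{p^\alpha}$.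
   Context: $(\mathcal{F}\Delta_A)(z)=\sum_{i}\Delta_A(i)\zeta^{iz}$ for a multiset $A$ of $\mathbb{Z}_{p^\alpha}$ with multiplicity function $\Delta_A$, $\zeta$ a primitive $p^\alpha$-th root of unity. $\uplus$ is multiset union. $O_r$ is the set of elements of additive order $p^r$. $\nu_p(z)$ is the largest $j\leqslant\alpha$ with $p^j\mid z$ ($\nu_p(0)=\alpha$). $p^{j}\mathbb{Z}_{p^\alpha}$ is the subgroup of multiples of $p^j$. -}

module Defs where

open import Level using (Level)
open import Data.Nat using (ℕ; zero; suc; _+_; _*_; _^_; _∸_; _≤_)
open import Data.Nat.Divisibility using (_∣_)
open import Data.Fin using (Fin; zero; suc; toℕ; opposite)
open import Data.Fin.Subset using (Subset; Side; inside; outside)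
open import Data.Vec using (lookup)
open import Data.Sum using (_⊎_)
open import Data.Product using (_×_; Σ)
open import Relation.Nullary using (¬_)
open import Relation.Binary.PropositionalEquality using (_≡_)
open import Algebra.Bundles using (CommutativeRing; Semiring)

-- Additive inverse in ℤ_n, elements represented by Fin n:
-- -0 = 0, and -(k+1) = n - (k+1) = suc (opposite k)  (opposite k = n-1-k).
neg : ∀ {n} → Fin n → Fin n
neg {suc n} zero    = zero
neg {suc n} (suc k) = suc (opposite k)

ind : Side → ℕ
ind inside  = 1
ind outside = 0

-- Multiplicity function Δ_{U_X} of the multiset U_X = X ⊎ (-X):
-- Δ_{U_X}(i) = [i ∈ X] + [-i ∈ X].
ΔU : ∀ {n} → Subset n → Fin n → ℕ
ΔU X i = ind (lookup X i) + ind (lookup X (neg i))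

IsValuation : (p α : ℕ) → Fin (p ^ α) → ℕ → Set
IsValuation p α z j =
  j ≤ α × (p ^ j) ∣ toℕ z × (∀ k → k ≤ α → (p ^ k) ∣ toℕ z → k ≤ j)

module _ {c ℓ : Level} (R : CommutativeRing c ℓ) where
  open CommutativeRing R renaming (_*_ to _*ᴿ_; _+_ to _+ᴿ_)
  open import Algebra.Definitions.RawSemiring (Semiring.rawSemiring semiring)
    renaming (_×_ to _·_; _^_ to _^ᴿ_) using (sum)

  Char0 : Set ℓ
  Char0 = ∀ n → (n · 1#) ≈ 0# → n ≡ 0

  NoZeroDivisors : Set (c Level.⊔ ℓ)
  NoZeroDivisors = ∀ x y → (x *ᴿ y) ≈ 0# → x ≈ 0# ⊎ y ≈ 0#

  PrimitiveRoot : (p α : ℕ) → Carrier → Set ℓ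
  PrimitiveRoot p α ζ = (ζ ^ᴿ (p ^ α)) ≈ 1# × ¬ ((ζ ^ᴿ (p ^ (α ∸ 1))) ≈ 1#)

  FΔU : ∀ {n} → Carrier → Subset n → Fin n → Carrier
  FΔU ζ X z = sum (λ i → ΔU X i · (ζ ^ᴿ (toℕ i * toℕ z)))

  negConst : ℕ → Carrier
  negConst m = - (m · 1#)

  IsMinValOnΓ : (p α : ℕ) → Carrier → Subset (p ^ α) → ℕ → ℕ → Set ℓ
  IsMinValOnΓ p α ζ X m β =
    Σ (Fin (p ^ α)) (λ z → FΔU ζ X z ≈ negConst m × IsValuation p α z β)
    × (∀ z j → FΔU ζ X z ≈ negConst m → IsValuation p α z j → β ≤ j)

module Submission where

-- Write F for the Fourier transform of Δ = Δ_{U_X} and n = p^α. For a prime l ≠ p with l ∤ m, the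
-- Frobenius congruence F(z)^l ≡ F(l z) (mod l ℤ[ζ]), the fact that l is not a unit of ℤ[ζ] and
-- F(z), F(l z) ∈ {0, -m} force F(l z) = F(z). Every k prime to p is congruent mod n to a product
-- of such primes, so F(z) depends only on ν_p(z), and Fourier inversion turns the values
-- Φ_e = F(p^e) into the integer recurrence
--   p^u g_u + γ_u m = γ_{u-1} m + p^u g_{u+1},   g_u = Δ(p^(α-u)) ∈ {0,1,2},  γ_u = [Φ_u = -m].
-- Since p ≥ 3 this forces g_u = 0 for u ≤ β and g_u = g_{β+1} ≠ 0 above β. An element lying in
-- exactly one of X and -X (one exists as X ≠ -X) has multiplicity 1, so that constant is 1.

module FiniteSums where

  open import Data.Nat as ℕ using (ℕ; zero; suc; _<_; _≤_; s≤s; z≤n)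
  import Data.Nat.Properties as ℕP
  open import Relation.Nullary using (Dec; yes; no; ¬_)
  open import Data.Empty using (⊥-elim)
  open import Relation.Binary.PropositionalEquality as P using (_≡_)
  open import Algebra.Bundles using (CommutativeSemiring)

  module Sums {c ℓ} (CS : CommutativeSemiring c ℓ) where
    open CommutativeSemiring CS
    open import Relation.Binary.Reasoning.Setoid setoid

    ∑ : ℕ → (ℕ → Carrier) → Carrier
    ∑ zero g = 0#
    ∑ (suc N) g = g 0 + ∑ N (λ i → g (suc i))

    ite : ∀ {a} {A : Set a} {x} {P : Set x} → Dec P → A → A → A
    ite (yes _) a b = a
    ite (no _) a b = b

    ∑-cong : ∀ N {g h} → (∀ i → i < N → g i ≈ h i) → ∑ N g ≈ ∑ N h
    ∑-cong zero e = refl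
    ∑-cong (suc N) e = +-cong (e 0 (s≤s z≤n)) (∑-cong N (λ i i<N → e (suc i) (s≤s i<N)))

    ∑-0# : ∀ N → ∑ N (λ _ → 0#) ≈ 0#
    ∑-0# zero = refl
    ∑-0# (suc N) = trans (+-identityˡ _) (∑-0# N)

    ∑-≈0# : ∀ N g → (∀ i → i < N → g i ≈ 0#) → ∑ N g ≈ 0#
    ∑-≈0# N g e = trans (∑-cong N e) (∑-0# N)

    ∑-distrib-+ : ∀ N g h → ∑ N (λ i → g i + h i) ≈ ∑ N g + ∑ N h
    ∑-distrib-+ zero g h = sym (+-identityˡ 0#)
    ∑-distrib-+ (suc N) g h = begin
      (g 0 + h 0) + ∑ N (λ i → g (suc i) + h (suc i))
        ≈⟨ +-congˡ (∑-distrib-+ N _ _) ⟩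
      (g 0 + h 0) + (∑ N (λ i → g (suc i)) + ∑ N (λ i → h (suc i)))
        ≈⟨ +-assoc _ _ _ ⟩
      g 0 + (h 0 + (∑ N (λ i → g (suc i)) + ∑ N (λ i → h (suc i))))
        ≈⟨ +-congˡ (trans (sym (+-assoc _ _ _)) (trans (+-congʳ (+-comm _ _)) (+-assoc _ _ _))) ⟩
      g 0 + (∑ N (λ i → g (suc i)) + (h 0 + ∑ N (λ i → h (suc i))))
        ≈⟨ sym (+-assoc _ _ _) ⟩
      (g 0 + ∑ N (λ i → g (suc i))) + (h 0 + ∑ N (λ i → h (suc i))) ∎

    *-distribˡ-∑ : ∀ N x g → x * ∑ N g ≈ ∑ N (λ i → x * g i)
    *-distribˡ-∑ zero x g = zeroʳ x
    *-distribˡ-∑ (suc N) x g = trans (distribˡ x _ _) (+-congˡ (*-distribˡ-∑ N x _))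

    *-distribʳ-∑ : ∀ N x g → ∑ N g * x ≈ ∑ N (λ i → g i * x)
    *-distribʳ-∑ N x g = trans (*-comm _ _) (trans (*-distribˡ-∑ N x g) (∑-cong N (λ i _ → *-comm _ _)))

    ∑-last : ∀ N g → ∑ (suc N) g ≈ ∑ N g + g N
    ∑-last zero g = trans (+-identityʳ _) (sym (+-identityˡ _))
    ∑-last (suc N) g = trans (+-congˡ (∑-last N _)) (sym (+-assoc _ _ _))

    ∑-split : ∀ N M g → ∑ (N ℕ.+ M) g ≈ ∑ N g + ∑ M (λ i → g (N ℕ.+ i))
    ∑-split zero M g = sym (+-identityˡ _)
    ∑-split (suc N) M g = trans (+-congˡ (∑-split N M _)) (sym (+-assoc _ _ _))

    ∑-comm : ∀ N M (g : ℕ → ℕ → Carrier) → ∑ N (λ i → ∑ M (λ j → g i j)) ≈ ∑ M (λ j → ∑ N (λ i → g i j))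
    ∑-comm zero M g = sym (∑-0# M)
    ∑-comm (suc N) M g = begin
      ∑ M (λ j → g 0 j) + ∑ N (λ i → ∑ M (λ j → g (suc i) j))
        ≈⟨ +-congˡ (∑-comm N M _) ⟩
      ∑ M (λ j → g 0 j) + ∑ M (λ j → ∑ N (λ i → g (suc i) j))
        ≈⟨ sym (∑-distrib-+ M _ _) ⟩
      ∑ M (λ j → ∑ (suc N) (λ i → g i j)) ∎

    ∑-single : ∀ N x (h : ℕ → Carrier) → x < N → (∀ k → k < N → ¬ (k ≡ x) → h k ≈ 0#) → ∑ N h ≈ h x
    ∑-single (suc N) zero h _ z = trans (+-congˡ (∑-≈0# N _ (λ i i<N → z (suc i) (s≤s i<N) (λ ())))) (+-identityʳ _)
    ∑-single (suc N) (suc x) h (s≤s x<N) z =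
      trans (+-congʳ (z 0 (s≤s z≤n) (λ ()))) (trans (+-identityˡ _)
        (∑-single N x (λ k → h (suc k)) x<N (λ k k<N k≢x → z (suc k) (s≤s k<N) (λ e → k≢x (P.cong ℕ.pred e)))))

    ∑-δ : ∀ N x (g : ℕ → Carrier) → x < N → ∑ N (λ k → ite (x ℕ.≟ k) (g k) 0#) ≈ g x
    ∑-δ N x g x<N = trans (∑-single N x _ x<N z) (lem (x ℕ.≟ x))
      where
      z : ∀ k → k < N → ¬ (k ≡ x) → ite (x ℕ.≟ k) (g k) 0# ≈ 0#
      z k _ k≢x with x ℕ.≟ k
      ... | yes e = ⊥-elim (k≢x (P.sym e))
      ... | no _ = refl
      lem : (d : Dec (x ≡ x)) → ite d (g x) 0# ≈ g x
      lem (yes _) = refl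
      lem (no ¬e) = ⊥-elim (¬e P.refl)

    open import Data.Nat.Divisibility using (_∣_; _∣?_; ∣m+n∣m⇒∣n; ∣m∣n⇒∣m+n; ∣-refl; ∣⇒≤; divides)

    private
      ¬∣small : ∀ a k → 0 < k → k < a → ¬ (a ∣ k)
      ¬∣small a (suc k) _ k<a a∣k = ℕP.<⇒≱ k<a (∣⇒≤ a∣k)

    ∑-multiples : ∀ a b g → 0 < a → ∑ (a ℕ.* b) (λ j → ite (a ∣? j) (g j) 0#) ≈ ∑ b (λ j → g (a ℕ.* j))
    ∑-multiples a zero g 0<a rewrite ℕP.*-zeroʳ a = refl
    ∑-multiples a (suc b) g 0<a rewrite ℕP.*-suc a b = begin
      ∑ (a ℕ.+ a ℕ.* b) h                        ≈⟨ ∑-split a (a ℕ.* b) h ⟩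
      ∑ a h + ∑ (a ℕ.* b) (λ i → h (a ℕ.+ i))    ≈⟨ +-cong first (∑-cong (a ℕ.* b) shift) ⟩
      g (a ℕ.* 0) + ∑ (a ℕ.* b) (λ i → ite (a ∣? i) (g (a ℕ.+ i)) 0#)
                                                 ≈⟨ +-congˡ (∑-multiples a b (λ i → g (a ℕ.+ i)) 0<a) ⟩
      g (a ℕ.* 0) + ∑ b (λ j → g (a ℕ.+ a ℕ.* j)) ≈⟨ +-congˡ (∑-cong b (λ j _ → reflexive (P.cong g (P.sym (ℕP.*-suc a j))))) ⟩
      ∑ (suc b) (λ j → g (a ℕ.* j)) ∎
      where
      h = λ j → ite (a ∣? j) (g j) 0#
      first : ∑ a h ≈ g (a ℕ.* 0)
      first = trans (∑-single a 0 h 0<a z) (lem (a ∣? 0))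
        where
        z : ∀ k → k < a → ¬ (k ≡ 0) → h k ≈ 0#
        z k k<a k≢0 with a ∣? k
        ... | yes a∣k = ⊥-elim (¬∣small a k (ℕP.n≢0⇒n>0 k≢0) k<a a∣k)
        ... | no _ = refl
        lem : (d : Dec (a ∣ 0)) → ite d (g 0) 0# ≈ g (a ℕ.* 0)
        lem (yes _) = reflexive (P.cong g (P.sym (ℕP.*-zeroʳ a)))
        lem (no ¬d) = ⊥-elim (¬d (divides 0 P.refl))
      shift : ∀ i → i < a ℕ.* b → h (a ℕ.+ i) ≈ ite (a ∣? i) (g (a ℕ.+ i)) 0#
      shift i _ with a ∣? (a ℕ.+ i) | a ∣? i
      ... | yes _ | yes _ = refl
      ... | no _ | no _ = refl
      ... | yes x | no y = ⊥-elim (y (∣m+n∣m⇒∣n x ∣-refl))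
      ... | no x | yes y = ⊥-elim (x (∣m∣n⇒∣m+n ∣-refl y))

    open import Algebra.Properties.Monoid.Mult +-monoid using (_×_)
    open import Algebra.Properties.CommutativeMonoid.Mult +-commutativeMonoid using (×-distrib-+)

    ×-0# : ∀ k → k × 0# ≈ 0#
    ×-0# zero = refl
    ×-0# (suc k) = trans (+-identityˡ _) (×-0# k)

    ∑-const : ∀ N x → ∑ N (λ _ → x) ≈ N × x
    ∑-const zero x = refl
    ∑-const (suc N) x = +-congˡ (∑-const N x)

    ×-distrib-∑ : ∀ N k g → k × ∑ N g ≈ ∑ N (λ i → k × g i)
    ×-distrib-∑ zero k g = ×-0# k
    ×-distrib-∑ (suc N) k g = trans (×-distrib-+ (g 0) (∑ N (λ i → g (suc i))) k) (+-congˡ (×-distrib-∑ N k _))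


module Arithmetic where

  open import Data.Nat
  open import Data.Nat.Properties
  open import Data.Nat.Divisibility
  open import Data.Nat.Primality
  open import Data.Nat.DivMod
  open import Data.Nat.Coprimality using (Coprime; coprime-Bézout; coprime-divisor)
  import Data.Nat.Coprimality as Coprimality
  open import Data.Nat.GCD using (module Bézout)
  open import Data.Nat.Induction using (<-rec)
  open import Data.Nat.Combinatorics using (_C_; nCk≡n!/k![n-k]!; k![n∸k]!∣n!)
  open import Data.Product using (Σ; _×_; _,_; proj₁; proj₂)
  open import Data.Sum using (_⊎_; inj₁; inj₂)
  open import Data.Empty using (⊥; ⊥-elim)
  open import Relation.Nullary using (¬_; yes; no)
  open import Relation.Binary.PropositionalEquality
  open import Data.Nat.Solver using (module +-*-Solver)
  open +-*-Solver
  open import Data.List using (List; filter)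
  open import Data.List.Membership.Propositional using (_∈_)
  open import Data.List.Membership.Propositional.Properties using (∈-filter⁺; ∈-filter⁻)
  open import Data.List.Relation.Unary.All.Properties using (filter⁺)
  open import Data.Nat.ListAction using (product)
  open import Data.Nat.ListAction.Properties using (∈⇒∣product)
  open import Data.Nat.Primality.Factorisation using (factorise; PrimeFactorisation; factorisationHasAllPrimeFactors; factors)
  open import Relation.Nullary using (¬?)

  ModEq : ℕ → ℕ → ℕ → Set
  ModEq n a b = Σ ℕ λ s → Σ ℕ λ t → a + s * n ≡ b + t * n

  modEq-* : ∀ {n a b} c → ModEq n a b → ModEq n (c * a) (c * b)
  modEq-* {n} {a} {b} c (s , t , e) = c * s , c * t ,
    trans (solve 4 (λ c a s n → c :* a :+ c :* s :* n := c :* (a :+ s :* n)) refl c a s n)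
     (trans (cong (c *_) e) (solve 4 (λ c b t n → c :* (b :+ t :* n) := c :* b :+ c :* t :* n) refl c b t n))

  modEq-% : ∀ n .{{_ : NonZero n}} a → ModEq n (a % n) a
  modEq-% n a = a / n , 0 , trans (sym (m≡m%n+[m/n]*n a n)) (sym (+-identityʳ a))

  n∣x<n⇒x≡0 : ∀ {n} x → x < n → n ∣ x → x ≡ 0
  n∣x<n⇒x≡0 zero _ _ = refl
  n∣x<n⇒x≡0 (suc x) lt n∣x = ⊥-elim (<⇒≱ lt (∣⇒≤ n∣x))

  n∣i+[n∸r]⇒r≡i : ∀ {n} i r → i < n → r < n → n ∣ i + (n ∸ r) → r ≡ i
  n∣i+[n∸r]⇒r≡i {n} i r i<n r<n n∣ with ≤-<-connex r i
  ... | inj₁ r≤i = ≤-antisym r≤i (m∸n≡0⇒m≤n (n∣x<n⇒x≡0 (i ∸ r) (≤-<-trans (m∸n≤m i r) i<n) n∣i∸r))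
    where
    e : i + (n ∸ r) ≡ n + (i ∸ r)
    e = trans (cong (_+ (n ∸ r)) (sym (m∸n+n≡m r≤i)))
         (trans (+-assoc (i ∸ r) r (n ∸ r)) (trans (cong ((i ∸ r) +_) (m+[n∸m]≡n (<⇒≤ r<n))) (+-comm (i ∸ r) n)))
    n∣i∸r : n ∣ i ∸ r
    n∣i∸r = ∣m+n∣m⇒∣n (subst (n ∣_) e n∣) ∣-refl
  ... | inj₂ i<r = ⊥-elim (x≢0 (n∣x<n⇒x≡0 x x<n n∣))
    where
    x = i + (n ∸ r)
    x<n : x < n
    x<n = subst (x <_) (m+[n∸m]≡n (<⇒≤ r<n)) (+-monoˡ-< (n ∸ r) i<r)
    x≢0 : x ≢ 0
    x≢0 e = <⇒≢ (m<n⇒0<n∸m r<n) (sym (m+n≡0⇒n≡0 i e))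

  ∣m∣n⇒∣m∸n : ∀ {d a b} → b ≤ a → d ∣ a → d ∣ b → d ∣ a ∸ b
  ∣m∣n⇒∣m∸n {d} b≤a (divides x a≡) (divides y b≡) = divides (x ∸ y) (trans (cong₂ _∸_ a≡ b≡) (sym (*-distribʳ-∸ d x y)))

  ∣n⇒[∣n∸j%n⇔∣j] : ∀ {d n} .{{_ : NonZero n}} → d ∣ n → ∀ j → (d ∣ n ∸ j % n → d ∣ j) × (d ∣ j → d ∣ n ∸ j % n)
  ∣n⇒[∣n∸j%n⇔∣j] {d} {n} d∣n j = to , from
    where
    r = j % n
    r≤n = <⇒≤ (m%n<n j n)
    d∣[j/n]*n : d ∣ (j / n) * n
    d∣[j/n]*n = ∣n⇒∣m*n (j / n) d∣n
    to : d ∣ n ∸ r → d ∣ j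
    to d∣n∸r = subst (d ∣_) (sym (m≡m%n+[m/n]*n j n)) (∣m∣n⇒∣m+n d∣r d∣[j/n]*n)
      where
      d∣r : d ∣ r
      d∣r = ∣m+n∣m⇒∣n (subst (d ∣_) (sym (m∸n+n≡m r≤n)) d∣n) d∣n∸r
    from : d ∣ j → d ∣ n ∸ r
    from d∣j = ∣m∣n⇒∣m∸n r≤n d∣n d∣r
      where
      d∣r : d ∣ r
      d∣r = ∣m+n∣m⇒∣n (subst (d ∣_) (trans (m≡m%n+[m/n]*n j n) (+-comm r _)) d∣j) d∣[j/n]*n

  prime≥2 : ∀ {p} → Prime p → 2 ≤ p
  prime≥2 {p} pr@(prime _) = nonTrivial⇒n>1 p {{prime⇒nonTrivial pr}}

  prime∣!⇒≤ : ∀ {ℓ} → Prime ℓ → ∀ m → ℓ ∣ m ! → ℓ ≤ m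
  prime∣!⇒≤ {ℓ} pr zero d = ⊥-elim (¬prime[1] (subst Prime (∣1⇒≡1 d) pr))
  prime∣!⇒≤ {ℓ} pr (suc m) d with euclidsLemma (suc m) (m !) pr d
  ... | inj₁ x = ∣⇒≤ x
  ... | inj₂ y = m≤n⇒m≤1+n (prime∣!⇒≤ pr m y)

  prime∣binomial : ∀ {ℓ} → Prime ℓ → ∀ k → 0 < k → k < ℓ → ℓ ∣ ℓ C k
  prime∣binomial {ℓ} pr k 0<k k<ℓ with euclidsLemma (ℓ C k) (k ! * (ℓ ∸ k) !) pr ℓ∣
    where
    k≤ℓ = <⇒≤ k<ℓ
    h = k![n∸k]!∣n! {ℓ} {k} k≤ℓ
    eq1 : ℓ ! ≡ (k ! * (ℓ ∸ k) !) * quotient h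
    eq1 = m∣n⇒n≡m*quotient h
    eq2 : ℓ C k ≡ quotient h
    eq2 = trans (nCk≡n!/k![n-k]! k≤ℓ) (n/m≡quotient h {{k !* (ℓ ∸ k) !≢0}})
    ℓ∣ℓ! : ℓ ∣ ℓ !
    ℓ∣ℓ! = f ℓ (prime≥2 pr)
      where
      f : ∀ x → 2 ≤ x → x ∣ x !
      f (suc x) _ = m∣m*n (x !)
    ℓ∣ : ℓ ∣ (ℓ C k) * (k ! * (ℓ ∸ k) !)
    ℓ∣ = subst (ℓ ∣_) (trans eq1 (trans (*-comm (k ! * (ℓ ∸ k) !) (quotient h)) (cong (λ v → v * (k ! * (ℓ ∸ k) !)) (sym eq2)))) ℓ∣ℓ!
  ... | inj₁ x = x
  ... | inj₂ y with euclidsLemma (k !) ((ℓ ∸ k) !) pr y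
  ...   | inj₁ a = ⊥-elim (<⇒≱ k<ℓ (prime∣!⇒≤ pr k a))
  ...   | inj₂ b = ⊥-elim (<⇒≱ (∸-monoʳ-< 0<k (<⇒≤ k<ℓ) ) (subst (_≤ ℓ ∸ k) refl (prime∣!⇒≤ pr (ℓ ∸ k) b)))

  prime∣^ : ∀ {ℓ} → Prime ℓ → ∀ m k → ℓ ∣ m ^ k → ℓ ∣ m
  prime∣^ pr m zero d = ⊥-elim (¬prime[1] (subst Prime (∣1⇒≡1 d) pr))
  prime∣^ pr m (suc k) d with euclidsLemma m (m ^ k) pr d
  ... | inj₁ x = x
  ... | inj₂ y = prime∣^ pr m k y

  prime∣prime : ∀ {ℓ p} → Prime ℓ → Prime p → ℓ ∣ p → ℓ ≡ p
  prime∣prime {ℓ} {p} prℓ prp d with prime⇒irreducible prp d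
  ... | inj₁ e = ⊥-elim (¬prime[1] (subst Prime e prℓ))
  ... | inj₂ e = e

  ¬∣⇒coprime : ∀ {l a} → Prime l → ¬ (l ∣ a) → Coprime a l
  ¬∣⇒coprime prl ¬l∣a (i∣a , i∣l) with prime⇒irreducible prl i∣l
  ... | inj₁ e = e
  ... | inj₂ refl = ⊥-elim (¬l∣a i∣a)

  module PrimePower (p : ℕ) (pr : Prime p) where
    instance
      p≢0 : NonZero p
      p≢0 = prime⇒nonZero pr

    p≥2 : 2 ≤ p
    p≥2 = prime≥2 pr

    p^-nonZero : ∀ k → NonZero (p ^ k)
    p^-nonZero k = m^n≢0 p k

    p^>0 : ∀ k → 0 < p ^ k
    p^>0 k = m^n>0 p k

    p^-mono-∣ : ∀ {a b} → a ≤ b → p ^ a ∣ p ^ b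
    p^-mono-∣ {a} {b} a≤b = divides (p ^ (b ∸ a)) (trans (cong (p ^_) (sym (m∸n+n≡m a≤b))) (^-distribˡ-+-* p (b ∸ a) a))

    p-adic-split : ∀ z → z ≢ 0 → Σ ℕ λ s → Σ ℕ λ u → (z ≡ p ^ s * u) × ¬ (p ∣ u)
    p-adic-split = <-rec _ go
      where
      go : ∀ z → (∀ {y} → y < z → y ≢ 0 → Σ ℕ λ s → Σ ℕ λ u → (y ≡ p ^ s * u) × ¬ (p ∣ u)) →
           z ≢ 0 → Σ ℕ λ s → Σ ℕ λ u → (z ≡ p ^ s * u) × ¬ (p ∣ u)
      go z rec z≢0 with p ∣? z
      ... | no ¬p∣z = 0 , z , sym (+-identityʳ z) , ¬p∣z
      ... | yes (divides q eq) with rec q<z q≢0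
        where
        q≢0 : q ≢ 0
        q≢0 q≡0 = z≢0 (trans eq (cong (_* p) q≡0))
        q<z : q < z
        q<z = subst (q <_) (sym eq) (m<m*n q p {{≢-nonZero q≢0}} p≥2)
      ...   | s , u , e , ¬p∣u = suc s , u , trans eq (trans (cong (_* p) e) lem) , ¬p∣u
        where
        lem : p ^ s * u * p ≡ p * p ^ s * u
        lem = solve 3 (λ a b c → b :* c :* a := a :* b :* c) refl p (p ^ s) u

    p^s*u<p^a⇒s<a : ∀ s u a → u ≢ 0 → p ^ s * u < p ^ a → s < a
    p^s*u<p^a⇒s<a s u a u≢0 lt with s <? a
    ... | yes x = x
    ... | no ¬x = ⊥-elim (<⇒≱ lt (≤-trans (^-monoʳ-≤ p (≮⇒≥ ¬x)) (m≤m*n (p ^ s) u {{≢-nonZero u≢0}})))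

    p^e∣p^s*u⇒e≤s : ∀ {u} → ¬ (p ∣ u) → ∀ e s → p ^ e ∣ p ^ s * u → e ≤ s
    p^e∣p^s*u⇒e≤s {u} ¬p∣u e s d with e ≤? s
    ... | yes x = x
    ... | no ¬x = ⊥-elim (¬p∣u (*-cancelˡ-∣ (p ^ s) {{p^-nonZero s}} d2))
      where
      d1 : p ^ suc s ∣ p ^ s * u
      d1 = ∣-trans (p^-mono-∣ (≰⇒> ¬x)) d
      d2 : p ^ s * p ∣ p ^ s * u
      d2 = subst (_∣ p ^ s * u) (*-comm p (p ^ s)) d1

    e≤s⇒p^e∣p^s*u : ∀ u e s → e ≤ s → p ^ e ∣ p ^ s * u
    e≤s⇒p^e∣p^s*u u e s e≤s = ∣-trans (p^-mono-∣ e≤s) (m∣m*n u)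

    coprime-p^ : ∀ {j} → ¬ (p ∣ j) → ∀ k → Coprime j (p ^ k)
    coprime-p^ {j} ¬p∣j k {d} (d∣j , d∣pk) = go k d∣pk
      where
      cdp : Coprime d p
      cdp {i} (i∣d , i∣p) with prime⇒irreducible pr i∣p
      ... | inj₁ e = e
      ... | inj₂ e = ⊥-elim (¬p∣j (subst (_∣ j) e (∣-trans i∣d d∣j)))
      go : ∀ k → d ∣ p ^ k → d ≡ 1
      go zero h = ∣1⇒≡1 h
      go (suc k) h = go k (coprime-divisor cdp h)

    p^k∣u*x⇒p^k∣x : ∀ {u} → ¬ (p ∣ u) → ∀ k x → p ^ k ∣ u * x → p ^ k ∣ x
    p^k∣u*x⇒p^k∣x ¬p∣u k x = coprime-divisor (Coprimality.sym (coprime-p^ ¬p∣u k))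

    prime∣p^⇒≡p : ∀ {ℓ} → Prime ℓ → ∀ k → ℓ ∣ p ^ k → ℓ ≡ p
    prime∣p^⇒≡p prℓ k d = prime∣prime prℓ pr (prime∣^ prℓ p k d)

    bézout⇒inverse-mod : ∀ n .{{_ : NonZero n}} j x s t → j * x + s * n ≡ 1 + t * n →
             Σ ℕ λ k0 → k0 < n × ModEq n (j * k0) 1
    bézout⇒inverse-mod n j x s t eq = x % n , m%n<n x n , (s + j * (x / n)) , t , trans lem eq
      where
      lem : j * (x % n) + (s + j * (x / n)) * n ≡ j * x + s * n
      lem = begin
        j * (x % n) + (s + j * (x / n)) * n ≡⟨ solve 5 (λ a b c d e → a :* b :+ (c :+ a :* d) :* e := a :* (b :+ d :* e) :+ c :* e) refl j (x % n) s (x / n) n ⟩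
        j * (x % n + x / n * n) + s * n     ≡⟨ cong (λ v → j * v + s * n) (sym (m≡m%n+[m/n]*n x n)) ⟩
        j * x + s * n ∎
        where open ≡-Reasoning

    inverse-mod-p^ : ∀ {j} → ¬ (p ∣ j) → ∀ α → Σ ℕ λ k0 → k0 < p ^ α × ModEq (p ^ α) (j * k0) 1
    inverse-mod-p^ {j} ¬p∣j α with p ^ α | p^-nonZero α | coprime-Bézout (coprime-p^ ¬p∣j α)
    ... | suc n' | _ | Bézout.Identity.+- x y eq = bézout⇒inverse-mod (suc n') j x 0 y (trans (+-identityʳ _) (trans (*-comm j x) (sym eq)))
    ... | suc n' | _ | Bézout.Identity.-+ x y eq = bézout⇒inverse-mod (suc n') j (n' * x) 1 (n' * y) lem
      where
      lem : j * (n' * x) + 1 * suc n' ≡ 1 + n' * y * suc n'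
      lem = begin
        j * (n' * x) + 1 * suc n'   ≡⟨ solve 3 (λ a b c → a :* (b :* c) :+ con 1 :* (con 1 :+ b) := b :* (con 1 :+ c :* a) :+ con 1) refl j n' x ⟩
        n' * (1 + x * j) + 1        ≡⟨ cong (λ v → n' * v + 1) eq ⟩
        n' * (y * suc n') + 1       ≡⟨ solve 3 (λ a b c → a :* (b :* c) :+ con 1 := con 1 :+ a :* b :* c) refl n' y (suc n') ⟩
        1 + n' * y * suc n' ∎
        where open ≡-Reasoning

    -- k' = k + r n, where r is the product of the prime factors of m that do not divide k.
    coprime-representative : ∀ n → p ∣ n → (∀ ℓ → Prime ℓ → ℓ ∣ n → ℓ ≡ p) → ∀ m .{{_ : NonZero m}} k → ¬ (p ∣ k) →
      Σ ℕ λ k' → k' ≢ 0 × ModEq n k k' × (∀ ℓ → Prime ℓ → ℓ ∣ k' → ℓ ≢ p × ¬ (ℓ ∣ m))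
    coprime-representative n p∣n onlyp m k ¬p∣k = k' , k'≢0 , (r , 0 , sym (+-identityʳ _)) , good
      where
      fm = factorise m
      P? = λ ℓ → ¬? (ℓ ∣? k)
      fs = filter P? (factors fm)
      r = product fs
      k' = k + r * n
      k'≢0 : k' ≢ 0
      k'≢0 e = ¬p∣k (subst (p ∣_) (sym (m+n≡0⇒m≡0 k e)) (divides 0 refl))
      allfs : _
      allfs = filter⁺ P? (PrimeFactorisation.factorsPrime fm)
      good : ∀ ℓ → Prime ℓ → ℓ ∣ k' → ℓ ≢ p × ¬ (ℓ ∣ m)
      good ℓ prℓ ℓ∣k' = ℓ≢p , ¬ℓ∣m
        where
        ℓ∣k'' : ℓ ∣ r * n + k
        ℓ∣k'' = subst (ℓ ∣_) (+-comm k (r * n)) ℓ∣k'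
        ℓ≢p : ℓ ≢ p
        ℓ≢p refl = ¬p∣k (∣m+n∣m⇒∣n ℓ∣k'' (∣n⇒∣m*n r p∣n))
        ¬ℓ∣m : ¬ (ℓ ∣ m)
        ¬ℓ∣m ℓ∣m with ℓ ∣? k
        ... | yes ℓ∣k with euclidsLemma r n prℓ (∣m+n∣m⇒∣n ℓ∣k' ℓ∣k)
        ...   | inj₂ ℓ∣n = ¬p∣k (subst (_∣ k) (onlyp ℓ prℓ ℓ∣n) ℓ∣k)
        ...   | inj₁ ℓ∣r = proj₂ (∈-filter⁻ P? {xs = factors fm} (factorisationHasAllPrimeFactors prℓ ℓ∣r allfs)) ℓ∣k
        ¬ℓ∣m ℓ∣m | no ¬ℓ∣k = ¬ℓ∣k (∣m+n∣m⇒∣n ℓ∣k'' (∣m⇒∣m*n n (∈⇒∣product ℓ∈fs)))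
          where
          ℓ∈fm : ℓ ∈ factors fm
          ℓ∈fm = factorisationHasAllPrimeFactors prℓ (subst (ℓ ∣_) (PrimeFactorisation.isFactorisation fm) ℓ∣m) (PrimeFactorisation.factorsPrime fm)
          ℓ∈fs : ℓ ∈ fs
          ℓ∈fs = ∈-filter⁺ P? ℓ∈fm ¬ℓ∣k

  delay : (ℕ → ℕ) → ℕ → ℕ
  delay f zero = 0
  delay f (suc u) = f u

  module ValuationRecurrence (p α m β : ℕ) (g γ : ℕ → ℕ) (p≥3 : 3 ≤ p) (m≥1 : 1 ≤ m) (β<α : β < α)
    (γβ : γ β ≡ 1) (γ<β : ∀ u → u < β → γ u ≡ 0) (γ≤1 : ∀ u → γ u ≤ 1)
    (g≤2 : ∀ u → g u ≤ 2) (g0≡0 : g 0 ≡ 0)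
    (EN : ∀ u → u < α → p ^ u * g u + γ u * m ≡ delay γ u * m + p ^ u * g (suc u)) where

    instance
      p≢0 : NonZero p
      p≢0 = >-nonZero (≤-trans (s≤s z≤n) p≥3)

    pw≢0 : ∀ k → NonZero (p ^ k)
    pw≢0 k = m^n≢0 p k

    delay-γ≡0-upto-β : ∀ u → u ≤ β → delay γ u ≡ 0
    delay-γ≡0-upto-β zero _ = refl
    delay-γ≡0-upto-β (suc u) su≤β = γ<β u su≤β

    g≡0-upto-β : ∀ u → u ≤ β → g u ≡ 0
    g≡0-upto-β zero _ = g0≡0
    g≡0-upto-β (suc u) u<β = *-cancelˡ-≡ (g (suc u)) 0 (p ^ u) {{pw≢0 u}} (sym (trans (*-zeroʳ (p ^ u)) eq'))
      where
      eq : p ^ u * g u + γ u * m ≡ delay γ u * m + p ^ u * g (suc u)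
      eq = EN u (<-trans u<β β<α)
      eq' : 0 ≡ p ^ u * g (suc u)
      eq' = begin
        0                                    ≡⟨ sym (trans (cong₂ _+_ (trans (cong (p ^ u *_) (g≡0-upto-β u (<⇒≤ u<β))) (*-zeroʳ (p ^ u))) (cong (_* m) (γ<β u u<β))) refl) ⟩
        p ^ u * g u + γ u * m                ≡⟨ eq ⟩
        delay γ u * m + p ^ u * g (suc u)         ≡⟨ cong (λ v → v * m + p ^ u * g (suc u)) (delay-γ≡0-upto-β u (<⇒≤ u<β)) ⟩
        p ^ u * g (suc u) ∎
        where open ≡-Reasoning

    g-top : ℕ
    g-top = g (suc β)

    m≡p^β*g-top : m ≡ p ^ β * g-top
    m≡p^β*g-top = begin
      m                               ≡⟨ sym (trans (cong (_* m) γβ) (*-identityˡ m)) ⟩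
      γ β * m                         ≡⟨ sym (trans (cong (λ v → p ^ β * v + γ β * m) (g≡0-upto-β β ≤-refl)) (cong (_+ γ β * m) (*-zeroʳ (p ^ β)))) ⟩
      p ^ β * g β + γ β * m           ≡⟨ EN β β<α ⟩
      delay γ β * m + p ^ β * g-top            ≡⟨ cong (λ v → v * m + p ^ β * g-top) (delay-γ≡0-upto-β β ≤-refl) ⟩
      p ^ β * g-top ∎
      where open ≡-Reasoning

    g-top≢0 : g-top ≢ 0
    g-top≢0 c≡0 = <⇒≢ m≥1 (sym (trans m≡p^β*g-top (trans (cong (p ^ β *_) c≡0) (*-zeroʳ (p ^ β)))))

    -- If γ u were 0 at some u = β + 1 + k, the recurrence would give p^u g-top = p^β g-top + p^u h,
    -- so p^(k+1) ≥ 3 would divide g-top ∈ {1, 2}.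
    recurrence-not-silent : ∀ k h → p ^ (suc β + k) * g-top ≡ m + p ^ (suc β + k) * h → ⊥
    recurrence-not-silent k h eq = <⇒≱ P≥3 (≤-trans (∣⇒≤ {{≢-nonZero g-top≢0}} P∣g-top) (g≤2 (suc β)))
      where
      u = suc β + k
      P = p ^ suc k
      P≥3 : 3 ≤ P
      P≥3 = ≤-trans p≥3 (m≤m*n p (p ^ k) {{pw≢0 k}})
      pu : p ^ u ≡ p ^ β * P
      pu = trans (cong (p ^_) (sym (+-suc β k))) (^-distribˡ-+-* p β (suc k))
      cancel-p^β : p ^ β * (P * g-top) ≡ p ^ β * (g-top + P * h)
      cancel-p^β = begin
        p ^ β * (P * g-top)               ≡⟨ sym (*-assoc (p ^ β) P g-top) ⟩
        p ^ β * P * g-top                 ≡⟨ cong (_* g-top) (sym pu) ⟩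
        p ^ u * g-top                     ≡⟨ eq ⟩
        m + p ^ u * h                     ≡⟨ cong₂ (λ a b → a + b * h) m≡p^β*g-top pu ⟩
        p ^ β * g-top + p ^ β * P * h     ≡⟨ cong (p ^ β * g-top +_) (*-assoc (p ^ β) P h) ⟩
        p ^ β * g-top + p ^ β * (P * h)   ≡⟨ sym (*-distribˡ-+ (p ^ β) g-top _) ⟩
        p ^ β * (g-top + P * h) ∎
        where open ≡-Reasoning
      P∣g-top : P ∣ g-top
      P∣g-top = ∣m+n∣m⇒∣n (subst (P ∣_) (trans (*-cancelˡ-≡ _ _ (p ^ β) {{pw≢0 β}} cancel-p^β) (+-comm g-top _)) (m∣m*n g-top)) (m∣m*n h)

    g-stable-above-β : ∀ k → suc β + k ≤ α → (g (suc β + k) ≡ g-top) × (γ (β + k) ≡ 1)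
    g-stable-above-β zero _ = cong g (cong suc (+-identityʳ β)) , trans (cong γ (+-identityʳ β)) γβ
    g-stable-above-β (suc k) le with g-stable-above-β k (≤-trans (+-monoʳ-≤ (suc β) (n≤1+n k)) le)
    ... | gu , γu = gnext , trans (cong γ (+-suc β k)) γu≡1
      where
      u = suc β + k
      u<α : u < α
      u<α = subst (_≤ α) (+-suc (suc β) k) le
      eq : p ^ u * g-top + γ u * m ≡ m + p ^ u * g (suc u)
      eq = trans (cong (λ v → p ^ u * v + γ u * m) (sym gu))
             (trans (EN u u<α) (trans (cong (λ v → v * m + p ^ u * g (suc u)) γu) (cong (_+ p ^ u * g (suc u)) (+-identityʳ m))))
      γu≡1 : γ u ≡ 1
      γu≡1 with γ u | γ≤1 u | eq
      ... | suc zero | _ | _ = refl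
      ... | zero | _ | eq0 = ⊥-elim (recurrence-not-silent k (g (suc u)) (trans (sym (+-identityʳ _)) eq0))
      ... | suc (suc _) | s≤s () | _
      gnext : g (suc β + suc k) ≡ g-top
      gnext = trans (cong g (+-suc (suc β) k)) (sym (*-cancelˡ-≡ g-top (g (suc u)) (p ^ u) {{pw≢0 u}} (+-cancelʳ-≡ m _ _ e)))
        where
        e : p ^ u * g-top + m ≡ p ^ u * g (suc u) + m
        e = trans (cong (λ v → p ^ u * g-top + v) (sym (trans (cong (_* m) γu≡1) (+-identityʳ m)))) (trans eq (+-comm m _))

    g≡g-top-above-β : ∀ u → β < u → u ≤ α → g u ≡ g-top
    g≡g-top-above-β u β<u u≤α = subst (λ v → g v ≡ g-top) (m+[n∸m]≡n β<u) (proj₁ (g-stable-above-β (u ∸ suc β) (subst (_≤ α) (sym (m+[n∸m]≡n β<u)) u≤α)))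


module CyclotomicIntegers where

  open import Level using (Level)
  open import Data.Nat as ℕ using (ℕ; zero; suc; _<_; _≤_; s≤s; z≤n; NonZero)
  import Data.Nat.Properties as ℕP
  open import Data.Nat.Divisibility as ℕD using (_∣_; _∣?_; divides)
  open import Data.Nat.DivMod using (_%_; _/_; m%n<n; m*[n/m]≡n; m<n⇒m%n≡m)
  open import Data.Nat.Divisibility using (m%n≡0⇒n∣m)
  open import Data.Nat.Primality using (Prime)
  open import Data.Nat.Coprimality using (coprime-Bézout)
  open import Data.Nat.GCD using (module Bézout)
  open import Data.Product using (Σ; _,_; proj₁; proj₂)
  open import Data.Sum using (_⊎_; inj₁; inj₂)
  open import Data.Empty using (⊥; ⊥-elim)
  open import Relation.Nullary using (¬_; yes; no; Dec)
  open import Relation.Binary.PropositionalEquality as P using (_≡_; _≢_)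
  open import Algebra.Bundles using (CommutativeRing)
  open import Defs
  open FiniteSums
  open Arithmetic

  module Cyclotomic {c ℓ'} (R : CommutativeRing c ℓ') (char0 : Char0 R) (nzd : NoZeroDivisors R)
    (p α : ℕ) (pr : Prime p) (α≥1 : 1 ≤ α) (ζ : CommutativeRing.Carrier R) (prim : PrimitiveRoot R p α ζ) where

    open CommutativeRing R
    open import Relation.Binary.Reasoning.Setoid setoid
    open import Algebra.Properties.Semiring.Exp semiring using (_^_; ^-homo-*; ^-assocʳ; ^-congˡ; ^-congʳ)
    open import Algebra.Properties.Semiring.Mult semiring using (_×_; ×-homo-+; ×-congʳ; ×-congˡ; ×-homo-1; ×-assocˡ; ×-comm-*; ×-assoc-*; ×1-homo-*)
    open import Algebra.Properties.CommutativeMonoid.Mult +-commutativeMonoid using (×-distrib-+)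
    open import Algebra.Solver.Ring.NaturalCoefficients.Default commutativeSemiring
    open import Algebra.Properties.Group +-group
      using (⁻¹-involutive; x∙y⁻¹≈ε⇒x≈y) renaming (∙-cancelˡ to +-cancelˡ; ∙-cancelʳ to +-cancelʳ)
    open import Algebra.Properties.Ring ring using (-‿distribˡ-*; -‿distribʳ-*)
    open Sums commutativeSemiring public
    module ∑ℕ = Sums ℕP.+-*-commutativeSemiring
    open PrimePower p pr

    n : ℕ
    n = p ℕ.^ α
    instance
      n≢0 : NonZero n
      n≢0 = p^-nonZero α
    q : ℕ
    q = p ℕ.^ (α ℕ.∸ 1)
    n≡pq : n ≡ p ℕ.* q
    n≡pq = lem α α≥1
      where
      lem : ∀ a → 1 ≤ a → p ℕ.^ a ≡ p ℕ.* p ℕ.^ (a ℕ.∸ 1)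
      lem (suc a) _ = P.refl
    ζn : ζ ^ n ≈ 1#
    ζn = proj₁ prim
    ζq : ¬ (ζ ^ q ≈ 1#)
    ζq = proj₂ prim

    1#^ : ∀ k → 1# ^ k ≈ 1#
    1#^ zero = refl
    1#^ (suc k) = trans (*-identityˡ _) (1#^ k)

    ×-homo-∑ℕ : ∀ N (g : ℕ → ℕ) x → (∑ℕ.∑ N g) × x ≈ ∑ N (λ i → g i × x)
    ×-homo-∑ℕ zero g x = refl
    ×-homo-∑ℕ (suc N) g x = trans (×-homo-+ x (g 0) (∑ℕ.∑ N (λ i → g (suc i)))) (+-congˡ (×-homo-∑ℕ N _ x))

    private
      ×1#-offset : ∀ {a d} → (a ℕ.+ d) × 1# ≈ a × 1# → d ≡ 0
      ×1#-offset {a} {d} e = char0 d (+-cancelˡ (a × 1#) (d × 1#) 0# (trans (sym (×-homo-+ 1# a d)) (trans e (sym (+-identityʳ _)))))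

    ×1#-injective : ∀ a b → a × 1# ≈ b × 1# → a ≡ b
    ×1#-injective a b e with ℕP.≤-total a b
    ... | inj₁ a≤b with ℕP.m≤n⇒∃[o]m+o≡n a≤b
    ...   | d , P.refl = P.sym (P.trans (P.cong (a ℕ.+_) (×1#-offset {a} (sym e))) (ℕP.+-identityʳ a))
    ×1#-injective a b e | inj₂ b≤a with ℕP.m≤n⇒∃[o]m+o≡n b≤a
    ...   | d , P.refl = P.trans (P.cong (b ℕ.+_) (×1#-offset {b} e)) (ℕP.+-identityʳ b)

    module RootOfUnity (y : Carrier) (yn : y ^ n ≈ 1#) where
      ^-multiple-of-n : ∀ k → y ^ (k ℕ.* n) ≈ 1#
      ^-multiple-of-n k = begin
        y ^ (k ℕ.* n)   ≈⟨ ^-congʳ y (ℕP.*-comm k n) ⟩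
        y ^ (n ℕ.* k)   ≈⟨ sym (^-assocʳ y n k) ⟩
        (y ^ n) ^ k     ≈⟨ ^-congˡ k yn ⟩
        1# ^ k          ≈⟨ 1#^ k ⟩
        1# ∎

      ^-modEq : ∀ {a b} → ModEq n a b → y ^ a ≈ y ^ b
      ^-modEq {a} {b} (s , t , e) = begin
        y ^ a                   ≈⟨ sym (*-identityʳ _) ⟩
        y ^ a * 1#              ≈⟨ *-congˡ (sym (^-multiple-of-n s)) ⟩
        y ^ a * y ^ (s ℕ.* n)   ≈⟨ sym (^-homo-* y a _) ⟩
        y ^ (a ℕ.+ s ℕ.* n)     ≈⟨ ^-congʳ y e ⟩
        y ^ (b ℕ.+ t ℕ.* n)     ≈⟨ ^-homo-* y b _ ⟩
        y ^ b * y ^ (t ℕ.* n)   ≈⟨ *-congˡ (^-multiple-of-n t) ⟩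
        y ^ b * 1#              ≈⟨ *-identityʳ _ ⟩
        y ^ b ∎

      ^-% : ∀ a → y ^ (a % n) ≈ y ^ a
      ^-% a = ^-modEq (modEq-% n a)

      ^-root : ∀ k → (y ^ k) ^ n ≈ 1#
      ^-root k = trans (^-assocʳ y k n) (^-multiple-of-n k)

    open RootOfUnity ζ ζn public using () renaming (^-multiple-of-n to ζ^-multiple-of-n; ^-modEq to ζ^-modEq; ^-% to ζ^-%)

    -- If 0 < a % n = p^s u with p ∤ u, raising ζ^(a % n) = 1 to the power u⁻¹ mod n gives ζ^(p^s) = 1,
    -- and then ζ^q = 1 as s < α.
    ζ^a≈1⇒n∣a : ∀ a → ζ ^ a ≈ 1# → n ∣ a
    ζ^a≈1⇒n∣a a e with a % n ℕ.≟ 0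
    ... | yes r≡0 = m%n≡0⇒n∣m a n r≡0
    ... | no r≢0 with p-adic-split (a % n) r≢0
    ...   | s , u , r≡ , ¬p∣u = ⊥-elim (ζq ζq≈1)
      where
      r = a % n
      u≢0 : u ≢ 0
      u≢0 P.refl = r≢0 (P.trans r≡ (ℕP.*-zeroʳ (p ℕ.^ s)))
      s<α : s < α
      s<α = p^s*u<p^a⇒s<a s u α u≢0 (P.subst (_< n) r≡ (m%n<n a n))
      ζr : ζ ^ r ≈ 1#
      ζr = trans (ζ^-% a) e
      inv = inverse-mod-p^ ¬p∣u α
      k0 = proj₁ inv
      cgk : ModEq n (p ℕ.^ s ℕ.* (u ℕ.* k0)) (p ℕ.^ s ℕ.* 1)
      cgk = modEq-* (p ℕ.^ s) (proj₂ (proj₂ inv))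
      ζps : ζ ^ (p ℕ.^ s) ≈ 1#
      ζps = begin
        ζ ^ (p ℕ.^ s)                   ≈⟨ ^-congʳ ζ (P.sym (ℕP.*-identityʳ (p ℕ.^ s))) ⟩
        ζ ^ (p ℕ.^ s ℕ.* 1)             ≈⟨ sym (ζ^-modEq cgk) ⟩
        ζ ^ (p ℕ.^ s ℕ.* (u ℕ.* k0))    ≈⟨ ^-congʳ ζ (P.trans (P.sym (ℕP.*-assoc (p ℕ.^ s) u k0)) (P.cong (ℕ._* k0) (P.sym r≡))) ⟩
        ζ ^ (r ℕ.* k0)                  ≈⟨ sym (^-assocʳ ζ r k0) ⟩
        (ζ ^ r) ^ k0                    ≈⟨ ^-congˡ k0 ζr ⟩
        1# ^ k0                         ≈⟨ 1#^ k0 ⟩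
        1# ∎
      qeq : q ≡ p ℕ.^ s ℕ.* p ℕ.^ (α ℕ.∸ 1 ℕ.∸ s)
      qeq = P.trans (P.cong (p ℕ.^_) (P.sym (ℕP.m+[n∸m]≡n (ℕP.<⇒≤pred s<α)))) (ℕP.^-distribˡ-+-* p s (α ℕ.∸ 1 ℕ.∸ s))
      ζq≈1 : ζ ^ q ≈ 1#
      ζq≈1 = begin
        ζ ^ q                                          ≈⟨ ^-congʳ ζ qeq ⟩
        ζ ^ (p ℕ.^ s ℕ.* p ℕ.^ (α ℕ.∸ 1 ℕ.∸ s))        ≈⟨ sym (^-assocʳ ζ (p ℕ.^ s) (p ℕ.^ (α ℕ.∸ 1 ℕ.∸ s))) ⟩
        (ζ ^ (p ℕ.^ s)) ^ (p ℕ.^ (α ℕ.∸ 1 ℕ.∸ s))      ≈⟨ ^-congˡ (p ℕ.^ (α ℕ.∸ 1 ℕ.∸ s)) ζps ⟩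
        1# ^ (p ℕ.^ (α ℕ.∸ 1 ℕ.∸ s))                   ≈⟨ 1#^ (p ℕ.^ (α ℕ.∸ 1 ℕ.∸ s)) ⟩
        1# ∎

    geometric-sum-shift : ∀ N y → y * ∑ N (y ^_) + 1# ≈ ∑ N (y ^_) + y ^ N
    geometric-sum-shift N y = begin
      y * ∑ N (y ^_) + 1#                     ≈⟨ +-comm _ _ ⟩
      1# + y * ∑ N (y ^_)                     ≈⟨ +-congˡ (*-distribˡ-∑ N y (y ^_)) ⟩
      ∑ (suc N) (y ^_)                        ≈⟨ ∑-last N (y ^_) ⟩
      ∑ N (y ^_) + y ^ N ∎

    geometric-sum-root : ∀ N y → y ^ N ≈ 1# → ¬ (y ≈ 1#) → ∑ N (y ^_) ≈ 0#
    geometric-sum-root N y yN y≉1 with nzd (y + - 1#) Sg prod0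
      where
      Sg = ∑ N (y ^_)
      ySg : y * Sg ≈ Sg
      ySg = +-cancelʳ 1# _ _ (trans (geometric-sum-shift N y) (+-congˡ yN))
      prod0 : (y + - 1#) * Sg ≈ 0#
      prod0 = begin
        (y + - 1#) * Sg       ≈⟨ distribʳ Sg y (- 1#) ⟩
        y * Sg + - 1# * Sg    ≈⟨ +-cong ySg (trans (*-comm _ _) (trans (sym (-‿distribʳ-* Sg 1#)) (-‿cong (*-identityʳ Sg)))) ⟩
        Sg + - Sg             ≈⟨ -‿inverseʳ Sg ⟩
        0# ∎
    ... | inj₁ e = ⊥-elim (y≉1 (x∙y⁻¹≈ε⇒x≈y y 1# e))
    ... | inj₂ e = e

    ite-∣1 : ∀ j (x : Carrier) → ite (1 ∣? j) x 0# ≈ x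
    ite-∣1 j x with 1 ∣? j
    ... | yes _ = refl
    ... | no ¬d = ⊥-elim (¬d (divides j (P.sym (ℕP.*-identityʳ j))))

    orthogonality-on-multiples : ∀ a b → a ℕ.* b ≡ n → 0 < a → ∀ w →
      ∑ n (λ j → ite (a ∣? j) (ζ ^ (j ℕ.* w)) 0#) ≈ ite (b ∣? w) (b × 1#) 0#
    orthogonality-on-multiples a b ab≡n 0<a w = begin
      ∑ n (λ j → ite (a ∣? j) (ζ ^ (j ℕ.* w)) 0#)     ≡⟨ P.cong (λ v → ∑ v (λ j → ite (a ∣? j) (ζ ^ (j ℕ.* w)) 0#)) (P.sym ab≡n) ⟩
      ∑ (a ℕ.* b) (λ j → ite (a ∣? j) (ζ ^ (j ℕ.* w)) 0#)  ≈⟨ ∑-multiples a b (λ j → ζ ^ (j ℕ.* w)) 0<a ⟩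
      ∑ b (λ j → ζ ^ (a ℕ.* j ℕ.* w))                 ≈⟨ ∑-cong b (λ j _ → trans (^-congʳ ζ (lem j)) (sym (^-assocʳ ζ (a ℕ.* w) j))) ⟩
      ∑ b (y ^_)                                      ≈⟨ fin (b ∣? w) ⟩
      ite (b ∣? w) (b × 1#) 0# ∎
      where
      y = ζ ^ (a ℕ.* w)
      lem : ∀ j → a ℕ.* j ℕ.* w ≡ a ℕ.* w ℕ.* j
      lem j = P.trans (ℕP.*-assoc a j w) (P.trans (P.cong (a ℕ.*_) (ℕP.*-comm j w)) (P.sym (ℕP.*-assoc a w j)))
      yb : y ^ b ≈ 1#
      yb = trans (^-assocʳ ζ (a ℕ.* w) b) (trans (^-congʳ ζ e) (ζ^-multiple-of-n w))
        where
        e : a ℕ.* w ℕ.* b ≡ w ℕ.* n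
        e = P.trans (ℕP.*-assoc a w b) (P.trans (P.cong (a ℕ.*_) (ℕP.*-comm w b)) (P.trans (P.sym (ℕP.*-assoc a b w)) (P.trans (P.cong (ℕ._* w) ab≡n) (ℕP.*-comm n w))))
      fin : (d : Dec (b ∣ w)) → ∑ b (y ^_) ≈ ite d (b × 1#) 0#
      fin (yes (divides t w≡)) = trans (∑-cong b (λ j _ → trans (^-congˡ j y≈1) (1#^ j))) (∑-const b 1#)
        where
        y≈1 : y ≈ 1#
        y≈1 = trans (^-congʳ ζ e) (ζ^-multiple-of-n t)
          where
          e : a ℕ.* w ≡ t ℕ.* n
          e = P.trans (P.cong (a ℕ.*_) w≡) (P.trans (P.cong (a ℕ.*_) (ℕP.*-comm t b)) (P.trans (P.sym (ℕP.*-assoc a b t)) (P.trans (P.cong (ℕ._* t) ab≡n) (ℕP.*-comm n t))))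
      fin (no ¬b∣w) = geometric-sum-root b y yb y≉1
        where
        y≉1 : ¬ (y ≈ 1#)
        y≉1 y≈1 = ¬b∣w (ℕD.*-cancelˡ-∣ a {{ℕ.>-nonZero 0<a}} (P.subst (_∣ a ℕ.* w) (P.sym ab≡n) (ζ^a≈1⇒n∣a (a ℕ.* w) y≈1)))

    orthogonality : ∀ w → ∑ n (λ j → ζ ^ (j ℕ.* w)) ≈ ite (n ∣? w) (n × 1#) 0#
    orthogonality w = trans (∑-cong n (λ j _ → sym (ite-∣1 j _))) (orthogonality-on-multiples 1 n (ℕP.*-identityˡ n) (s≤s z≤n) w)

    Coeffs : Set
    Coeffs = ℕ → ℕ

    eval : Carrier → Coeffs → Carrier
    eval y c = ∑ n (λ i → c i × y ^ i)

    δ : ℕ → Coeffs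
    δ x i = ∑ℕ.ite (x ℕ.≟ i) 1 0

    convolve : Coeffs → Coeffs → Coeffs
    convolve c d k = ∑ℕ.∑ n (λ i → ∑ℕ.∑ n (λ j → ∑ℕ.ite ((i ℕ.+ j) % n ℕ.≟ k) (c i ℕ.* d j) 0))

    dilate : ℕ → Coeffs → Coeffs
    dilate k c i = ∑ℕ.∑ n (λ i' → ∑ℕ.ite ((k ℕ.* i') % n ℕ.≟ i) (c i') 0)

    ×-ite : ∀ {a} {A : Set a} (d : Dec A) (m : ℕ) x → (∑ℕ.ite d m 0) × x ≈ ite d (m × x) 0#
    ×-ite (yes _) m x = refl
    ×-ite (no _) m x = refl

    ×-*-interchange : ∀ a b u v → (a ℕ.* b) × (u * v) ≈ (a × u) * (b × v)
    ×-*-interchange a b u v = sym (begin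
      (a × u) * (b × v)  ≈⟨ ×-assoc-* a u (b × v) ⟩
      a × (u * (b × v))  ≈⟨ ×-congʳ a (×-comm-* b u v) ⟩
      a × (b × (u * v))  ≈⟨ ×-assocˡ (u * v) a b ⟩
      (a ℕ.* b) × (u * v) ∎)

    eval-cong : ∀ {y y'} c → y ≈ y' → eval y c ≈ eval y' c
    eval-cong c e = ∑-cong n (λ i _ → ×-congʳ (c i) (^-congˡ i e))

    eval-+ : ∀ y c d → eval y (λ i → c i ℕ.+ d i) ≈ eval y c + eval y d
    eval-+ y c d = trans (∑-cong n (λ i _ → ×-homo-+ (y ^ i) (c i) (d i))) (∑-distrib-+ n _ _)

    eval-× : ∀ y k c → eval y (λ i → k ℕ.* c i) ≈ k × eval y c
    eval-× y k c = trans (∑-cong n (λ i _ → sym (×-assocˡ (y ^ i) k (c i)))) (sym (×-distrib-∑ n k _))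

    eval-δ : ∀ y x → x < n → eval y (δ x) ≈ y ^ x
    eval-δ y x x<n = trans (∑-cong n (λ i _ → ×-ite (x ℕ.≟ i) 1 (y ^ i))) (trans (∑-δ n x (λ i → 1 × y ^ i) x<n) (×-homo-1 _))

    module EvalAtRoot (y : Carrier) (yn : y ^ n ≈ 1#) where
      open RootOfUnity y yn

      eval-convolve : ∀ c d → eval y (convolve c d) ≈ eval y c * eval y d
      eval-convolve c d = begin
        eval y (convolve c d)
          ≈⟨ ∑-cong n (λ k _ → trans (×-homo-∑ℕ n _ (y ^ k)) (∑-cong n (λ i _ → ×-homo-∑ℕ n _ (y ^ k)))) ⟩
        ∑ n (λ k → ∑ n (λ i → ∑ n (λ j → (∑ℕ.ite ((i ℕ.+ j) % n ℕ.≟ k) (c i ℕ.* d j) 0) × y ^ k)))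
          ≈⟨ ∑-comm n n _ ⟩
        ∑ n (λ i → ∑ n (λ k → ∑ n (λ j → (∑ℕ.ite ((i ℕ.+ j) % n ℕ.≟ k) (c i ℕ.* d j) 0) × y ^ k)))
          ≈⟨ ∑-cong n (λ i _ → ∑-comm n n _) ⟩
        ∑ n (λ i → ∑ n (λ j → ∑ n (λ k → (∑ℕ.ite ((i ℕ.+ j) % n ℕ.≟ k) (c i ℕ.* d j) 0) × y ^ k)))
          ≈⟨ ∑-cong n (λ i _ → ∑-cong n (λ j _ → inner i j)) ⟩
        ∑ n (λ i → ∑ n (λ j → (c i × y ^ i) * (d j × y ^ j)))
          ≈⟨ ∑-cong n (λ i _ → sym (*-distribˡ-∑ n _ _)) ⟩
        ∑ n (λ i → (c i × y ^ i) * eval y d)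
          ≈⟨ sym (*-distribʳ-∑ n _ _) ⟩
        eval y c * eval y d ∎
        where
        inner : ∀ i j → ∑ n (λ k → (∑ℕ.ite ((i ℕ.+ j) % n ℕ.≟ k) (c i ℕ.* d j) 0) × y ^ k) ≈ (c i × y ^ i) * (d j × y ^ j)
        inner i j = begin
          ∑ n (λ k → (∑ℕ.ite ((i ℕ.+ j) % n ℕ.≟ k) (c i ℕ.* d j) 0) × y ^ k)
            ≈⟨ ∑-cong n (λ k _ → ×-ite ((i ℕ.+ j) % n ℕ.≟ k) _ _) ⟩
          ∑ n (λ k → ite ((i ℕ.+ j) % n ℕ.≟ k) ((c i ℕ.* d j) × y ^ k) 0#)
            ≈⟨ ∑-δ n ((i ℕ.+ j) % n) (λ k → (c i ℕ.* d j) × y ^ k) (m%n<n _ n) ⟩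
          (c i ℕ.* d j) × y ^ ((i ℕ.+ j) % n)
            ≈⟨ ×-congʳ (c i ℕ.* d j) (trans (^-% (i ℕ.+ j)) (^-homo-* y i j)) ⟩
          (c i ℕ.* d j) × (y ^ i * y ^ j)
            ≈⟨ ×-*-interchange (c i) (d j) _ _ ⟩
          (c i × y ^ i) * (d j × y ^ j) ∎

      eval-dilate : ∀ k c → eval y (dilate k c) ≈ eval (y ^ k) c
      eval-dilate k c = begin
        eval y (dilate k c)
          ≈⟨ ∑-cong n (λ i _ → ×-homo-∑ℕ n _ (y ^ i)) ⟩
        ∑ n (λ i → ∑ n (λ i' → (∑ℕ.ite ((k ℕ.* i') % n ℕ.≟ i) (c i') 0) × y ^ i))
          ≈⟨ ∑-comm n n _ ⟩
        ∑ n (λ i' → ∑ n (λ i → (∑ℕ.ite ((k ℕ.* i') % n ℕ.≟ i) (c i') 0) × y ^ i))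
          ≈⟨ ∑-cong n (λ i' _ → inner i') ⟩
        eval (y ^ k) c ∎
        where
        inner : ∀ i' → ∑ n (λ i → (∑ℕ.ite ((k ℕ.* i') % n ℕ.≟ i) (c i') 0) × y ^ i) ≈ c i' × (y ^ k) ^ i'
        inner i' = begin
          ∑ n (λ i → (∑ℕ.ite ((k ℕ.* i') % n ℕ.≟ i) (c i') 0) × y ^ i)
            ≈⟨ ∑-cong n (λ i _ → ×-ite ((k ℕ.* i') % n ℕ.≟ i) _ _) ⟩
          ∑ n (λ i → ite ((k ℕ.* i') % n ℕ.≟ i) (c i' × y ^ i) 0#)
            ≈⟨ ∑-δ n ((k ℕ.* i') % n) (λ i → c i' × y ^ i) (m%n<n _ n) ⟩
          c i' × y ^ ((k ℕ.* i') % n)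
            ≈⟨ ×-congʳ (c i') (trans (^-% (k ℕ.* i')) (sym (^-assocʳ y k i'))) ⟩
          c i' × (y ^ k) ^ i' ∎

    evalζ : Coeffs → Carrier
    evalζ = eval ζ

    -- Natural coefficients suffice for ℤ[ζ], since -1 = ζ + ζ² + ⋯ + ζ^(n-1).
    Inℤ[ζ] : Carrier → Set ℓ'
    Inℤ[ζ] x = Σ Coeffs λ v → x ≈ evalζ v

    Inℤ[ζ]-resp : ∀ {x y} → x ≈ y → Inℤ[ζ] x → Inℤ[ζ] y
    Inℤ[ζ]-resp e (v , x≈) = v , trans (sym e) x≈

    Inℤ[ζ]-0# : Inℤ[ζ] 0#
    Inℤ[ζ]-0# = (λ _ → 0) , sym (∑-0# n)

    Inℤ[ζ]-+ : ∀ {a b} → Inℤ[ζ] a → Inℤ[ζ] b → Inℤ[ζ] (a + b)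
    Inℤ[ζ]-+ (v , a≈) (w , b≈) = (λ i → v i ℕ.+ w i) , trans (+-cong a≈ b≈) (sym (eval-+ ζ v w))

    Inℤ[ζ]-* : ∀ {a b} → Inℤ[ζ] a → Inℤ[ζ] b → Inℤ[ζ] (a * b)
    Inℤ[ζ]-* (v , a≈) (w , b≈) = convolve v w , trans (*-cong a≈ b≈) (sym (EvalAtRoot.eval-convolve ζ ζn v w))

    Inℤ[ζ]-× : ∀ k {a} → Inℤ[ζ] a → Inℤ[ζ] (k × a)
    Inℤ[ζ]-× k (v , a≈) = (λ i → k ℕ.* v i) , trans (×-congʳ k a≈) (sym (eval-× ζ k v))

    Inℤ[ζ]-ζ^ : ∀ a → Inℤ[ζ] (ζ ^ a)
    Inℤ[ζ]-ζ^ a = δ (a % n) , trans (sym (ζ^-% a)) (sym (eval-δ ζ (a % n) (m%n<n a n)))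

    Inℤ[ζ]-1# : Inℤ[ζ] 1#
    Inℤ[ζ]-1# = Inℤ[ζ]-ζ^ 0

    Inℤ[ζ]-∑ : ∀ N g → (∀ i → i < N → Inℤ[ζ] (g i)) → Inℤ[ζ] (∑ N g)
    Inℤ[ζ]-∑ zero g h = Inℤ[ζ]-0#
    Inℤ[ζ]-∑ (suc N) g h = Inℤ[ζ]-+ (h 0 (s≤s z≤n)) (Inℤ[ζ]-∑ N (λ i → g (suc i)) (λ i i<N → h (suc i) (s≤s i<N)))

    Inℤ[ζ]-^ : ∀ {a} → Inℤ[ζ] a → ∀ k → Inℤ[ζ] (a ^ k)
    Inℤ[ζ]-^ ta zero = Inℤ[ζ]-1#
    Inℤ[ζ]-^ ta (suc k) = Inℤ[ζ]-* ta (Inℤ[ζ]-^ ta k)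

    ζ≉1 : ¬ (ζ ≈ 1#)
    ζ≉1 e = ℕP.<⇒≱ n>1 (ℕD.∣⇒≤ (ζ^a≈1⇒n∣a 1 (trans (*-identityʳ ζ) e)))
      where
      n>1 : 1 < n
      n>1 = ℕP.<-≤-trans (prime≥2 pr) (P.subst (p ≤_) (P.sym n≡pq) (ℕP.m≤m*n p q {{p^-nonZero (α ℕ.∸ 1)}}))

    minusOne : Coeffs
    minusOne i = ∑ℕ.ite (0 ℕ.≟ i) 0 1

    evalζ-minusOne : evalζ minusOne + 1# ≈ 0#
    evalζ-minusOne = begin
      evalζ minusOne + 1#              ≈⟨ +-congˡ (sym (eval-δ ζ 0 (p^>0 α))) ⟩
      evalζ minusOne + evalζ (δ 0)        ≈⟨ sym (eval-+ ζ minusOne (δ 0)) ⟩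
      evalζ (λ i → minusOne i ℕ.+ δ 0 i) ≈⟨ ∑-cong n (λ i _ → trans (×-congˡ (lem i (0 ℕ.≟ i))) (×-homo-1 _)) ⟩
      ∑ n (ζ ^_)              ≈⟨ geometric-sum-root n ζ ζn ζ≉1 ⟩
      0# ∎
      where
      lem : ∀ i (d : Dec (0 ≡ i)) → ∑ℕ.ite d 0 1 ℕ.+ ∑ℕ.ite d 1 0 ≡ 1
      lem i (yes _) = P.refl
      lem i (no _) = P.refl

    Inℤ[ζ]--1# : Inℤ[ζ] (- 1#)
    Inℤ[ζ]--1# = minusOne , +-cancelʳ 1# (- 1#) (evalζ minusOne) (trans (-‿inverseˡ 1#) (sym evalζ-minusOne))

    Inℤ[ζ]-neg : ∀ {a} → Inℤ[ζ] a → Inℤ[ζ] (- a)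
    Inℤ[ζ]-neg {a} ta = Inℤ[ζ]-resp (trans (sym (-‿distribʳ-* a 1#)) (-‿cong (*-identityʳ a))) (Inℤ[ζ]-* ta Inℤ[ζ]--1#)

    infix 4 _≡[_]_
    record _≡[_]_ (x : Carrier) (l : ℕ) (y : Carrier) : Set (c Level.⊔ ℓ') where
      constructor congruence
      field
        quotient : Carrier
        quotient∈ℤ[ζ] : Inℤ[ζ] quotient
        equation : x ≈ y + l × quotient

    ≡[]-reflexive : ∀ {l x y} → x ≈ y → x ≡[ l ] y
    ≡[]-reflexive {l} {x} {y} e = congruence 0# Inℤ[ζ]-0# (trans e (trans (sym (+-identityʳ y)) (+-congˡ (sym (×-0# l)))))

    ≡[]-trans : ∀ {l x y z} → x ≡[ l ] y → y ≡[ l ] z → x ≡[ l ] z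
    ≡[]-trans {l} {x} {y} {z} (congruence t tt e1) (congruence t' tt' e2) = congruence (t' + t) (Inℤ[ζ]-+ tt' tt) (begin
      x                      ≈⟨ e1 ⟩
      y + l × t              ≈⟨ +-congʳ e2 ⟩
      (z + l × t') + l × t   ≈⟨ +-assoc _ _ _ ⟩
      z + (l × t' + l × t)   ≈⟨ +-congˡ (sym (×-distrib-+ t' t l)) ⟩
      z + l × (t' + t) ∎)

    ≡[]-+ : ∀ {l x x' y y'} → x ≡[ l ] x' → y ≡[ l ] y' → (x + y) ≡[ l ] (x' + y')
    ≡[]-+ {l} {x} {x'} {y} {y'} (congruence t tt e1) (congruence t' tt' e2) = congruence (t + t') (Inℤ[ζ]-+ tt tt') (begin
      x + y                          ≈⟨ +-cong e1 e2 ⟩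
      (x' + l × t) + (y' + l × t')   ≈⟨ solve 4 (λ a b c d → (a :+ b) :+ (c :+ d) := (a :+ c) :+ (b :+ d)) refl x' (l × t) y' (l × t') ⟩
      (x' + y') + (l × t + l × t')   ≈⟨ +-congˡ (sym (×-distrib-+ t t' l)) ⟩
      (x' + y') + l × (t + t') ∎)

    open import Algebra.Definitions.RawMonoid +-rawMonoid using (sum)
    open import Data.Fin using (toℕ)
    import Algebra.Properties.CommutativeSemiring.Binomial commutativeSemiring as Bin
    open import Data.Nat.Combinatorics using (_C_; nCn≡1)

    sum≈∑ : ∀ N (g : ℕ → Carrier) → sum {N} (λ i → g (toℕ i)) ≈ ∑ N g
    sum≈∑ zero g = refl
    sum≈∑ (suc N) g = +-congˡ (sum≈∑ N (λ i → g (suc i)))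

    binomial-∑ : ∀ N a b → (a + b) ^ N ≈ ∑ (suc N) (λ k → (N C k) × (a ^ k * b ^ (N ℕ.∸ k)))
    binomial-∑ N a b = trans (Bin.theorem N a b) (sum≈∑ (suc N) (λ k → (N C k) × (a ^ k * b ^ (N ℕ.∸ k))))

    module Frobenius (l : ℕ) (prl : Prime l) where
      l≥2 : 2 ≤ l
      l≥2 = prime≥2 prl
      instance
        l≢0 : NonZero l
        l≢0 = ℕ.>-nonZero (ℕP.<-trans (s≤s z≤n) l≥2)

      0#^≈0# : ∀ L → 2 ≤ L → 0# ^ L ≈ 0#
      0#^≈0# (suc L) _ = zeroˡ _

      frobenius-+ : ∀ a b → Inℤ[ζ] a → Inℤ[ζ] b → (a + b) ^ l ≡[ l ] (a ^ l + b ^ l)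
      frobenius-+ a b ta tb = go l l≥2 P.refl
        where
        go : ∀ L → 2 ≤ L → L ≡ l → (a + b) ^ l ≡[ l ] (a ^ l + b ^ l)
        go (suc (suc l'')) _ P.refl = congruence M M∈ℤ[ζ] (begin
          (a + b) ^ l                 ≈⟨ binomial-∑ l a b ⟩
          g 0 + ∑ l (λ k → g (suc k))  ≈⟨ +-cong g0≈b^l (∑-last (suc l'') (λ k → g (suc k))) ⟩
          b ^ l + (∑ (suc l'') (λ k → g (suc k)) + g l)  ≈⟨ +-congˡ (+-cong middle≈l×M gl≈a^l) ⟩
          b ^ l + (l × M + a ^ l)      ≈⟨ solve 3 (λ x y z → x :+ (y :+ z) := (z :+ x) :+ y) refl (b ^ l) (l × M) (a ^ l) ⟩
          (a ^ l + b ^ l) + l × M ∎)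
          where
          l' = suc l''
          g : ℕ → Carrier
          g k = (l C k) × (a ^ k * b ^ (l ℕ.∸ k))
          h : ℕ → Carrier
          h k = ((l C suc k) ℕ./ l) × (a ^ suc k * b ^ (l ℕ.∸ suc k))
          M = ∑ l' h
          M∈ℤ[ζ] : Inℤ[ζ] M
          M∈ℤ[ζ] = Inℤ[ζ]-∑ l' h (λ k _ → Inℤ[ζ]-× ((l C suc k) ℕ./ l) (Inℤ[ζ]-* (Inℤ[ζ]-^ ta (suc k)) (Inℤ[ζ]-^ tb (l ℕ.∸ suc k))))
          g0≈b^l : g 0 ≈ b ^ l
          g0≈b^l = trans (×-homo-1 _) (*-identityˡ _)
          gl≈a^l : g l ≈ a ^ l
          gl≈a^l = begin
            (l C l) × (a ^ l * b ^ (l ℕ.∸ l))  ≈⟨ ×-congˡ (nCn≡1 l) ⟩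
            1 × (a ^ l * b ^ (l ℕ.∸ l))        ≈⟨ ×-homo-1 _ ⟩
            a ^ l * b ^ (l ℕ.∸ l)              ≈⟨ *-congˡ (^-congʳ b (ℕP.n∸n≡0 l)) ⟩
            a ^ l * 1#                         ≈⟨ *-identityʳ _ ⟩
            a ^ l ∎
          middle≈l×M : ∑ l' (λ k → g (suc k)) ≈ l × M
          X : ℕ → Carrier
          X k = a ^ suc k * b ^ (l ℕ.∸ suc k)
          middle≈l×M = trans (∑-cong l' (λ k k<l' → trans (×-congˡ {X k} (P.sym (m*[n/m]≡n (prime∣binomial prl (suc k) (s≤s z≤n) (s≤s k<l')))))
                                                (sym (×-assocˡ (X k) l ((l C suc k) ℕ./ l))))) (sym (×-distrib-∑ l' l h))

      frobenius-monomial : ∀ f e → (f × ζ ^ e) ^ l ≡[ l ] (f × ζ ^ (l ℕ.* e))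
      frobenius-monomial zero e = ≡[]-reflexive (0#^≈0# l l≥2)
      frobenius-monomial (suc f) e = ≡[]-trans (frobenius-+ (ζ ^ e) (f × ζ ^ e) (Inℤ[ζ]-ζ^ e) (Inℤ[ζ]-× f (Inℤ[ζ]-ζ^ e)))
        (≡[]-+ (≡[]-reflexive (trans (^-assocʳ ζ e l) (^-congʳ ζ (ℕP.*-comm e l)))) (frobenius-monomial f e))

      frobenius-∑ : ∀ N (f e : ℕ → ℕ) → (∑ N (λ i → f i × ζ ^ e i)) ^ l ≡[ l ] ∑ N (λ i → f i × ζ ^ (l ℕ.* e i))
      frobenius-∑ zero f e = ≡[]-reflexive (0#^≈0# l l≥2)
      frobenius-∑ (suc N) f e = ≡[]-trans (frobenius-+ _ _ (Inℤ[ζ]-× (f 0) (Inℤ[ζ]-ζ^ (e 0))) (Inℤ[ζ]-∑ N _ (λ i _ → Inℤ[ζ]-× (f (suc i)) (Inℤ[ζ]-ζ^ (e (suc i))))))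
        (≡[]-+ (frobenius-monomial (f 0) (e 0)) (frobenius-∑ N (λ i → f (suc i)) (λ i → e (suc i))))

    -- With D = 1 + l c0 coefficientwise, D(ζ) = 0, so W = ∏_{K<n} D(x^K) vanishes at every ζ^j with
    -- p ∤ j; a trace computation then gives W 0 = W q, whereas W ≡ δ0 (mod l) coefficientwise: l ∣ 1.
    module PrimeNotUnit (l : ℕ) (prl : Prime l) (c0 : Coeffs) (hyp : 1# + l × evalζ c0 ≈ 0#) where
      δ0 : Coeffs
      δ0 = δ 0

      D : Coeffs
      D i = δ0 i ℕ.+ l ℕ.* c0 i

      evD : evalζ D ≈ 0#
      evD = trans (eval-+ ζ δ0 (λ i → l ℕ.* c0 i)) (trans (+-cong (eval-δ ζ 0 (p^>0 α)) (eval-× ζ l c0)) hyp)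

      G : ℕ → Coeffs
      G zero = δ0
      G (suc K) = convolve (dilate K D) (G K)

      G-vanishes : ∀ y → y ^ n ≈ 1# → ∀ K k0 → k0 < K → eval (y ^ k0) D ≈ 0# → eval y (G K) ≈ 0#
      G-vanishes y yn (suc K) k0 k0<K e = trans (EvalAtRoot.eval-convolve y yn (dilate K D) (G K))
        (trans (*-congʳ (EvalAtRoot.eval-dilate y yn K D)) (fin (ℕP.m≤n⇒m<n∨m≡n (ℕP.≤-pred k0<K))))
        where
        fin : k0 < K ⊎ k0 ≡ K → eval (y ^ K) D * eval y (G K) ≈ 0#
        fin (inj₁ lt) = trans (*-congˡ (G-vanishes y yn K k0 lt e)) (zeroʳ _)
        fin (inj₂ P.refl) = trans (*-congʳ e) (zeroˡ _)

      W : Coeffs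
      W = G n

      W-vanishes-at-ζ^j : ∀ j → ¬ (p ∣ j) → eval (ζ ^ j) W ≈ 0#
      W-vanishes-at-ζ^j j ¬p∣j = G-vanishes (ζ ^ j) (RootOfUnity.^-root ζ ζn j) n k0 k0<n e
        where
        inv = inverse-mod-p^ ¬p∣j α
        k0 = proj₁ inv
        k0<n = proj₁ (proj₂ inv)
        e : eval ((ζ ^ j) ^ k0) D ≈ 0#
        e = trans (eval-cong D (trans (^-assocʳ ζ j k0) (trans (ζ^-modEq (proj₂ (proj₂ inv))) (*-identityʳ ζ)))) evD

      open import Data.Nat.Solver using (module +-*-Solver)
      module NS = +-*-Solver

      0%n : 0 % n ≡ 0
      0%n = m<n⇒m%n≡m (p^>0 α)

      ite-+-* : ∀ {a} {A : Set a} (d : Dec A) x y → ∑ℕ.ite d (x ℕ.+ l ℕ.* y) 0 ≡ ∑ℕ.ite d x 0 ℕ.+ l ℕ.* ∑ℕ.ite d y 0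
      ite-+-* (yes _) x y = P.refl
      ite-+-* (no _) x y = P.sym (ℕP.*-zeroʳ l)

      ite-0-0 : ∀ {a} {A : Set a} (d : Dec A) → ∑ℕ.ite d 0 0 ≡ 0
      ite-0-0 (yes _) = P.refl
      ite-0-0 (no _) = P.refl

      δ0-off-zero : ∀ i → i ≢ 0 → δ0 i ≡ 0
      δ0-off-zero i i≢0 with 0 ℕ.≟ i
      ... | yes e = ⊥-elim (i≢0 (P.sym e))
      ... | no _ = P.refl

      dilate-δ0 : ∀ K i → ∑ℕ.∑ n (λ i' → ∑ℕ.ite ((K ℕ.* i') % n ℕ.≟ i) (δ0 i') 0) ≡ δ0 i
      dilate-δ0 K i = P.trans (∑ℕ.∑-single n 0 _ (p^>0 α) z) lem
        where
        z : ∀ k → k < n → k ≢ 0 → ∑ℕ.ite ((K ℕ.* k) % n ℕ.≟ i) (δ0 k) 0 ≡ 0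
        z k _ k≢0 rewrite δ0-off-zero k k≢0 = ite-0-0 _
        lem : ∑ℕ.ite ((K ℕ.* 0) % n ℕ.≟ i) (δ0 0) 0 ≡ δ0 i
        lem rewrite ℕP.*-zeroʳ K | 0%n = P.refl

      G≡δ0-mod-l : ∀ K → Σ Coeffs λ H → ∀ i → G K i ≡ δ0 i ℕ.+ l ℕ.* H i
      G≡δ0-mod-l zero = (λ _ → 0) , λ i → P.sym (P.trans (P.cong (δ0 i ℕ.+_) (ℕP.*-zeroʳ l)) (ℕP.+-identityʳ _))
      G≡δ0-mod-l (suc K) with G≡δ0-mod-l K
      ... | Hb , hb = Hc , hc
        where
        A = dilate K D
        Ha : Coeffs
        Ha i = ∑ℕ.∑ n (λ i' → ∑ℕ.ite ((K ℕ.* i') % n ℕ.≟ i) (c0 i') 0)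
        ha : ∀ i → A i ≡ δ0 i ℕ.+ l ℕ.* Ha i
        ha i = P.trans (∑ℕ.∑-cong n (λ i' _ → ite-+-* ((K ℕ.* i') % n ℕ.≟ i) (δ0 i') (c0 i')))
                 (P.trans (∑ℕ.∑-distrib-+ n _ _) (P.cong₂ ℕ._+_ (dilate-δ0 K i) (P.sym (∑ℕ.*-distribˡ-∑ n l _))))
        B = G K
        Hc : Coeffs
        Hc k = ∑ℕ.∑ n (λ i → ∑ℕ.∑ n (λ j → ∑ℕ.ite ((i ℕ.+ j) % n ℕ.≟ k) (Ha i ℕ.* B j ℕ.+ δ0 i ℕ.* Hb j) 0))
        prod : ∀ i j → A i ℕ.* B j ≡ δ0 i ℕ.* δ0 j ℕ.+ l ℕ.* (Ha i ℕ.* B j ℕ.+ δ0 i ℕ.* Hb j)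
        prod i j rewrite ha i | hb j = NS.solve 5 (λ a b c d e → (a NS.:+ e NS.:* b) NS.:* (c NS.:+ e NS.:* d) NS.:= a NS.:* c NS.:+ e NS.:* (b NS.:* (c NS.:+ e NS.:* d) NS.:+ a NS.:* d)) P.refl (δ0 i) (Ha i) (δ0 j) (Hb j) l
        main : ∀ k → ∑ℕ.∑ n (λ i → ∑ℕ.∑ n (λ j → ∑ℕ.ite ((i ℕ.+ j) % n ℕ.≟ k) (δ0 i ℕ.* δ0 j) 0)) ≡ δ0 k
        main k = P.trans (∑ℕ.∑-single n 0 _ (p^>0 α) zi) (P.trans (∑ℕ.∑-single n 0 _ (p^>0 α) zj) lem)
          where
          zi : ∀ i → i < n → i ≢ 0 → ∑ℕ.∑ n (λ j → ∑ℕ.ite ((i ℕ.+ j) % n ℕ.≟ k) (δ0 i ℕ.* δ0 j) 0) ≡ 0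
          zi i _ i≢0 rewrite δ0-off-zero i i≢0 = ∑ℕ.∑-≈0# n _ (λ j _ → ite-0-0 _)
          zj : ∀ j → j < n → j ≢ 0 → ∑ℕ.ite ((0 ℕ.+ j) % n ℕ.≟ k) (δ0 0 ℕ.* δ0 j) 0 ≡ 0
          zj j _ j≢0 rewrite δ0-off-zero j j≢0 = ite-0-0 _
          lem : ∑ℕ.ite ((0 ℕ.+ 0) % n ℕ.≟ k) (δ0 0 ℕ.* δ0 0) 0 ≡ δ0 k
          lem rewrite 0%n = P.refl
        hc : ∀ k → convolve A B k ≡ δ0 k ℕ.+ l ℕ.* Hc k
        hc k = P.trans (∑ℕ.∑-cong n (λ i _ → ∑ℕ.∑-cong n (λ j _ →
                   P.trans (P.cong (λ v → ∑ℕ.ite ((i ℕ.+ j) % n ℕ.≟ k) v 0) (prod i j)) (ite-+-* ((i ℕ.+ j) % n ℕ.≟ k) _ _))))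
               (P.trans (∑ℕ.∑-cong n (λ i _ → ∑ℕ.∑-distrib-+ n _ _)) (P.trans (∑ℕ.∑-distrib-+ n _ _)
               (P.cong₂ ℕ._+_ (main k) (P.trans (∑ℕ.∑-cong n (λ i _ → P.sym (∑ℕ.*-distribˡ-∑ n l _))) (P.sym (∑ℕ.*-distribˡ-∑ n l _))))))

      ∑-eval-W-expand : ∀ (u : ℕ → Carrier) → ∑ n (λ j → u j * eval (ζ ^ j) W) ≈ ∑ n (λ i → W i × ∑ n (λ j → u j * ζ ^ (j ℕ.* i)))
      ∑-eval-W-expand u = begin
        ∑ n (λ j → u j * eval (ζ ^ j) W)
          ≈⟨ ∑-cong n (λ j _ → *-distribˡ-∑ n (u j) _) ⟩
        ∑ n (λ j → ∑ n (λ i → u j * (W i × (ζ ^ j) ^ i)))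
          ≈⟨ ∑-cong n (λ j _ → ∑-cong n (λ i _ → trans (×-comm-* (W i) (u j) _) (×-congʳ (W i) (*-congˡ (^-assocʳ ζ j i))))) ⟩
        ∑ n (λ j → ∑ n (λ i → W i × (u j * ζ ^ (j ℕ.* i))))
          ≈⟨ ∑-comm n n _ ⟩
        ∑ n (λ i → ∑ n (λ j → W i × (u j * ζ ^ (j ℕ.* i))))
          ≈⟨ ∑-cong n (λ i _ → sym (×-distrib-∑ n (W i) _)) ⟩
        ∑ n (λ i → W i × ∑ n (λ j → u j * ζ ^ (j ℕ.* i))) ∎

      ζ^-*-join : ∀ j a b → ζ ^ (j ℕ.* a) * ζ ^ (j ℕ.* b) ≈ ζ ^ (j ℕ.* (b ℕ.+ a))
      ζ^-*-join j a b = trans (sym (^-homo-* ζ (j ℕ.* a) (j ℕ.* b))) (^-congʳ ζ (P.trans (ℕP.+-comm (j ℕ.* a) (j ℕ.* b)) (P.sym (ℕP.*-distribˡ-+ j b a))))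

      A : ℕ → ℕ
      A r = ∑ℕ.∑ n (λ i → ∑ℕ.ite (q ∣? (i ℕ.+ (n ℕ.∸ r))) (W i) 0)

      W-orthogonality : ∀ r i → r < n → i < n →
        W i × ∑ n (λ j → ζ ^ (j ℕ.* (n ℕ.∸ r)) * ζ ^ (j ℕ.* i)) ≈ ite (r ℕ.≟ i) (W i × (n × 1#)) 0#
      W-orthogonality r i r<n i<n = begin
        W i × ∑ n (λ j → ζ ^ (j ℕ.* w) * ζ ^ (j ℕ.* i))
          ≈⟨ ×-congʳ (W i) (trans (∑-cong n (λ j _ → ζ^-*-join j w i)) (orthogonality (i ℕ.+ w))) ⟩
        W i × ite (n ∣? (i ℕ.+ w)) (n × 1#) 0#
          ≈⟨ lem (n ∣? (i ℕ.+ w)) (r ℕ.≟ i) ⟩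
        ite (r ℕ.≟ i) (W i × (n × 1#)) 0# ∎
        where
        w = n ℕ.∸ r
        lem : (d1 : Dec (n ∣ i ℕ.+ w)) (d2 : Dec (r ≡ i)) → W i × ite d1 (n × 1#) 0# ≈ ite d2 (W i × (n × 1#)) 0#
        lem (yes _) (yes _) = refl
        lem (no _) (no _) = ×-0# (W i)
        lem (yes x) (no y) = ⊥-elim (y (n∣i+[n∸r]⇒r≡i i r i<n r<n x))
        lem (no x) (yes P.refl) = ⊥-elim (x (P.subst (n ∣_) (P.sym (ℕP.m+[n∸m]≡n (ℕP.<⇒≤ r<n))) ℕD.∣-refl))

      drop-unit-exponents : ∀ w j → ζ ^ (j ℕ.* w) * eval (ζ ^ j) W ≈ ite (p ∣? j) (ζ ^ (j ℕ.* w)) 0# * eval (ζ ^ j) W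
      drop-unit-exponents w j with p ∣? j
      ... | yes _ = refl
      ... | no ¬p∣j = trans (*-congˡ (W-vanishes-at-ζ^j j ¬p∣j)) (trans (zeroʳ _) (sym (zeroˡ _)))

      W-orthogonality-on-multiples : ∀ w i →
        W i × ∑ n (λ j → ite (p ∣? j) (ζ ^ (j ℕ.* w)) 0# * ζ ^ (j ℕ.* i)) ≈ (∑ℕ.ite (q ∣? (i ℕ.+ w)) (W i) 0) × (q × 1#)
      W-orthogonality-on-multiples w i = begin
        W i × ∑ n (λ j → ite (p ∣? j) (ζ ^ (j ℕ.* w)) 0# * ζ ^ (j ℕ.* i))
          ≈⟨ ×-congʳ (W i) (∑-cong n (λ j _ → join j)) ⟩
        W i × ∑ n (λ j → ite (p ∣? j) (ζ ^ (j ℕ.* (i ℕ.+ w))) 0#)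
          ≈⟨ ×-congʳ (W i) (orthogonality-on-multiples p q (P.sym n≡pq) (ℕP.<-trans (s≤s z≤n) (prime≥2 pr)) (i ℕ.+ w)) ⟩
        W i × ite (q ∣? (i ℕ.+ w)) (q × 1#) 0#
          ≈⟨ lem (q ∣? (i ℕ.+ w)) ⟩
        (∑ℕ.ite (q ∣? (i ℕ.+ w)) (W i) 0) × (q × 1#) ∎
        where
        join : ∀ j → ite (p ∣? j) (ζ ^ (j ℕ.* w)) 0# * ζ ^ (j ℕ.* i) ≈ ite (p ∣? j) (ζ ^ (j ℕ.* (i ℕ.+ w))) 0#
        join j with p ∣? j
        ... | yes _ = ζ^-*-join j w i
        ... | no _ = zeroˡ _
        lem : ∀ {a} {X : Set a} (d : Dec X) → W i × ite d (q × 1#) 0# ≈ (∑ℕ.ite d (W i) 0) × (q × 1#)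
        lem (yes _) = refl
        lem (no _) = ×-0# (W i)

      -- Both sides are ∑_j ζ^(-jr) W(ζ^j): over all j by orthogonality, and over p ∣ j only since
      -- W vanishes at the other powers of ζ.
      trace-formula : ∀ r → r < n → n ℕ.* W r ≡ A r ℕ.* q
      trace-formula r r<n = ×1#-injective _ _ (begin
        (n ℕ.* W r) × 1#
          ≈⟨ trans (×-congˡ (ℕP.*-comm n (W r))) (sym (×-assocˡ 1# (W r) n)) ⟩
        W r × (n × 1#)
          ≈⟨ sym (∑-δ n r (λ i → W i × (n × 1#)) r<n) ⟩
        ∑ n (λ i → ite (r ℕ.≟ i) (W i × (n × 1#)) 0#)
          ≈⟨ ∑-cong n (λ i i<n → sym (W-orthogonality r i r<n i<n)) ⟩
        ∑ n (λ i → W i × ∑ n (λ j → ζ ^ (j ℕ.* w) * ζ ^ (j ℕ.* i)))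
          ≈⟨ sym (∑-eval-W-expand (λ j → ζ ^ (j ℕ.* w))) ⟩
        ∑ n (λ j → ζ ^ (j ℕ.* w) * eval (ζ ^ j) W)
          ≈⟨ ∑-cong n (λ j _ → drop-unit-exponents w j) ⟩
        ∑ n (λ j → ite (p ∣? j) (ζ ^ (j ℕ.* w)) 0# * eval (ζ ^ j) W)
          ≈⟨ ∑-eval-W-expand (λ j → ite (p ∣? j) (ζ ^ (j ℕ.* w)) 0#) ⟩
        ∑ n (λ i → W i × ∑ n (λ j → ite (p ∣? j) (ζ ^ (j ℕ.* w)) 0# * ζ ^ (j ℕ.* i)))
          ≈⟨ ∑-cong n (λ i _ → W-orthogonality-on-multiples w i) ⟩
        ∑ n (λ i → (∑ℕ.ite (q ∣? (i ℕ.+ w)) (W i) 0) × (q × 1#))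
          ≈⟨ trans (sym (×-homo-∑ℕ n _ (q × 1#))) (×-assocˡ 1# (A r) q) ⟩
        (A r ℕ.* q) × 1# ∎)
        where
        w = n ℕ.∸ r

      q<n : q < n
      q<n = P.subst (q <_) (P.trans (ℕP.*-comm q p) (P.sym n≡pq)) (ℕP.m<m*n q p {{p^-nonZero (α ℕ.∸ 1)}} (prime≥2 pr))

      q≢0 : q ≢ 0
      q≢0 = ℕP.n>0⇒n≢0 (p^>0 (α ℕ.∸ 1))

      q∣n : q ∣ n
      q∣n = divides p n≡pq

      q∣n-q : q ∣ n ℕ.∸ q
      q∣n-q = divides (p ℕ.∸ 1) (P.trans (P.cong (ℕ._∸ q) n≡pq) (P.trans (P.cong (p ℕ.* q ℕ.∸_) (P.sym (ℕP.*-identityˡ q))) (P.sym (ℕP.*-distribʳ-∸ q p 1))))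

      A0≡Aq : A 0 ≡ A q
      A0≡Aq = ∑ℕ.∑-cong n (λ i _ → pt i)
        where
        f1 : ∀ i → q ∣ i ℕ.+ n → q ∣ i
        f1 i d = ℕD.∣m+n∣m⇒∣n (P.subst (q ∣_) (ℕP.+-comm i n) d) q∣n
        pt : ∀ i → ∑ℕ.ite (q ∣? (i ℕ.+ n)) (W i) 0 ≡ ∑ℕ.ite (q ∣? (i ℕ.+ (n ℕ.∸ q))) (W i) 0
        pt i with q ∣? (i ℕ.+ n) | q ∣? (i ℕ.+ (n ℕ.∸ q))
        ... | yes _ | yes _ = P.refl
        ... | no _ | no _ = P.refl
        ... | yes x | no y = ⊥-elim (y (ℕD.∣m∣n⇒∣m+n (f1 i x) q∣n-q))
        ... | no x | yes y = ⊥-elim (x (ℕD.∣m∣n⇒∣m+n (ℕD.∣m+n∣m⇒∣n (P.subst (q ∣_) (ℕP.+-comm i _) y) q∣n-q) q∣n))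

      W0≡Wq : W 0 ≡ W q
      W0≡Wq = ℕP.*-cancelˡ-≡ (W 0) (W q) n (P.trans (trace-formula 0 (p^>0 α)) (P.trans (P.cong (ℕ._* q) A0≡Aq) (P.sym (trace-formula q q<n))))

      contradiction : ⊥
      contradiction with G≡δ0-mod-l n
      ... | H , h = ℕP.<⇒≢ (prime≥2 prl) (P.sym (ℕD.∣1⇒≡1 l∣1))
        where
        e : 1 ℕ.+ l ℕ.* H 0 ≡ l ℕ.* H q
        e = P.trans (P.sym (h 0)) (P.trans W0≡Wq (P.trans (h q) (P.cong (ℕ._+ l ℕ.* H q) (δ0-off-zero q q≢0))))
        l∣1 : l ∣ 1
        l∣1 = ℕD.∣m+n∣m⇒∣n (P.subst (l ∣_) (P.trans (P.sym e) (ℕP.+-comm 1 (l ℕ.* H 0))) (ℕD.m∣m*n (H q))) (ℕD.m∣m*n (H 0))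

    prime-not-unit : ∀ l → Prime l → ∀ t → Inℤ[ζ] t → ¬ (1# + l × t ≈ 0#)
    prime-not-unit l prl t (c0 , t≈) e = PrimeNotUnit.contradiction l prl c0 (trans (+-congˡ (×-congʳ l (sym t≈))) e)

    1+l×u≉l×v : ∀ l → Prime l → ∀ u v → Inℤ[ζ] u → Inℤ[ζ] v → 1# + l × u ≈ l × v → ⊥
    1+l×u≉l×v l prl u v tu tv e = prime-not-unit l prl (u + - v) (Inℤ[ζ]-+ tu (Inℤ[ζ]-neg tv)) lem
      where
      lem : 1# + l × (u + - v) ≈ 0#
      lem = +-cancelʳ (l × v) _ _ (begin
        (1# + l × (u + - v)) + l × v         ≈⟨ +-congʳ (+-congˡ (×-distrib-+ u (- v) l)) ⟩
        (1# + (l × u + l × (- v))) + l × v   ≈⟨ solve 4 (λ a b c d → (a :+ (b :+ c)) :+ d := (a :+ b) :+ (c :+ d)) refl 1# (l × u) (l × (- v)) (l × v) ⟩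
        (1# + l × u) + (l × (- v) + l × v)   ≈⟨ +-cong e (trans (sym (×-distrib-+ (- v) v l)) (trans (×-congʳ l (-‿inverseˡ v)) (×-0# l))) ⟩
        l × v + 0#                           ≈⟨ +-comm _ _ ⟩
        0# + l × v ∎)

    ×-swap : ∀ a b x → (a ℕ.* b) × x ≈ b × (a × x)
    ×-swap a b x = trans (×-congˡ (ℕP.*-comm a b)) (sym (×-assocˡ x b a))

    ¬∣⇒¬∣-in-ℤ[ζ] : ∀ l → Prime l → ∀ a → ¬ (l ∣ a) → ∀ t → Inℤ[ζ] t → a × 1# ≈ l × t → ⊥
    ¬∣⇒¬∣-in-ℤ[ζ] l prl a ¬l∣a t tt e with coprime-Bézout (¬∣⇒coprime prl ¬l∣a)
    ... | Bézout.Identity.+- x y eq = 1+l×u≉l×v l prl (y × 1#) (x × t) (Inℤ[ζ]-× y Inℤ[ζ]-1#) (Inℤ[ζ]-× x tt) (begin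
          1# + l × (y × 1#)       ≈⟨ +-cong (sym (×-homo-1 1#)) (sym (×-swap y l 1#)) ⟩
          1 × 1# + (y ℕ.* l) × 1#  ≈⟨ sym (×-homo-+ 1# 1 (y ℕ.* l)) ⟩
          (1 ℕ.+ y ℕ.* l) × 1#     ≈⟨ ×-congˡ eq ⟩
          (x ℕ.* a) × 1#           ≈⟨ sym (×-assocˡ 1# x a) ⟩
          x × (a × 1#)             ≈⟨ ×-congʳ x e ⟩
          x × (l × t)              ≈⟨ ×-assocˡ t x l ⟩
          (x ℕ.* l) × t            ≈⟨ ×-swap x l t ⟩
          l × (x × t) ∎)
    ... | Bézout.Identity.-+ x y eq = 1+l×u≉l×v l prl (x × t) (y × 1#) (Inℤ[ζ]-× x tt) (Inℤ[ζ]-× y Inℤ[ζ]-1#) (begin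
          1# + l × (x × t)          ≈⟨ +-cong (sym (×-homo-1 1#)) (sym (×-swap x l t)) ⟩
          1 × 1# + (x ℕ.* l) × t     ≈⟨ +-congˡ (sym (×-assocˡ t x l)) ⟩
          1 × 1# + x × (l × t)       ≈⟨ +-congˡ (×-congʳ x (sym e)) ⟩
          1 × 1# + x × (a × 1#)      ≈⟨ +-congˡ (×-assocˡ 1# x a) ⟩
          1 × 1# + (x ℕ.* a) × 1#    ≈⟨ sym (×-homo-+ 1# 1 (x ℕ.* a)) ⟩
          (1 ℕ.+ x ℕ.* a) × 1#       ≈⟨ ×-congˡ eq ⟩
          (y ℕ.* l) × 1#             ≈⟨ ×-swap y l 1# ⟩
          l × (y × 1#) ∎)

    ×-neg : ∀ k x → k × (- x) ≈ - (k × x)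
    ×-neg k x = +-cancelʳ (k × x) _ _ (trans (sym (×-distrib-+ (- x) x k)) (trans (×-congʳ k (-‿inverseˡ x)) (trans (×-0# k) (sym (-‿inverseˡ (k × x))))))

    -x^k≈±x^k : ∀ k x → ((- x) ^ k ≈ x ^ k) ⊎ ((- x) ^ k ≈ - (x ^ k))
    -x^k≈±x^k zero x = inj₁ refl
    -x^k≈±x^k (suc k) x with -x^k≈±x^k k x
    ... | inj₁ e = inj₂ (trans (*-congˡ e) (sym (-‿distribˡ-* x (x ^ k))))
    ... | inj₂ e = inj₁ (trans (*-congˡ e) (trans (sym (-‿distribʳ-* (- x) (x ^ k))) (trans (-‿cong (sym (-‿distribˡ-* x (x ^ k)))) (⁻¹-involutive _))))

    ×1#-homo-^ : ∀ a k → (a × 1#) ^ k ≈ (a ℕ.^ k) × 1#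
    ×1#-homo-^ a zero = sym (×-homo-1 1#)
    ×1#-homo-^ a (suc k) = trans (*-congˡ (×1#-homo-^ a k)) (sym (×1-homo-* a (a ℕ.^ k)))

    frobenius-rigid : ∀ l → Prime l → ∀ m → ¬ (l ∣ m) → ∀ {x y} →
      x ≈ 0# ⊎ x ≈ - (m × 1#) → y ≈ 0# ⊎ y ≈ - (m × 1#) → x ^ l ≡[ l ] y → y ≈ x
    frobenius-rigid l prl m ¬l∣m (inj₁ x≈0) (inj₁ y≈0) _ = trans y≈0 (sym x≈0)
    frobenius-rigid l prl m ¬l∣m (inj₂ x≈-m) (inj₂ y≈-m) _ = trans y≈-m (sym x≈-m)
    frobenius-rigid l prl m ¬l∣m {x} {y} (inj₁ x≈0) (inj₂ y≈-m) (congruence t tt eq) =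
      ⊥-elim (¬∣⇒¬∣-in-ℤ[ζ] l prl m ¬l∣m t tt (begin
        M                      ≈⟨ sym (+-identityʳ M) ⟩
        M + 0#                 ≈⟨ +-congˡ (sym (Frobenius.0#^≈0# l prl l (prime≥2 prl))) ⟩
        M + 0# ^ l             ≈⟨ +-congˡ (^-congˡ l (sym x≈0)) ⟩
        M + x ^ l              ≈⟨ +-congˡ eq ⟩
        M + (y + l × t)        ≈⟨ +-congˡ (+-congʳ y≈-m) ⟩
        M + (- M + l × t)      ≈⟨ sym (+-assoc _ _ _) ⟩
        (M + - M) + l × t      ≈⟨ +-congʳ (-‿inverseʳ M) ⟩
        0# + l × t             ≈⟨ +-identityˡ _ ⟩
        l × t ∎))
      where
      M = m × 1#
    frobenius-rigid l prl m ¬l∣m {x} {y} (inj₂ x≈-m) (inj₁ y≈0) (congruence t tt eq) = ⊥-elim (from-sign (-x^k≈±x^k l M))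
      where
      M = m × 1#
      [-M]^l≈l×t : (- M) ^ l ≈ l × t
      [-M]^l≈l×t = trans (^-congˡ l (sym x≈-m)) (trans eq (trans (+-congʳ y≈0) (+-identityˡ _)))
      ¬l∣m^l : ¬ (l ∣ m ℕ.^ l)
      ¬l∣m^l l∣m^l = ¬l∣m (prime∣^ prl m l l∣m^l)
      from-sign : ((- M) ^ l ≈ M ^ l) ⊎ ((- M) ^ l ≈ - (M ^ l)) → ⊥
      from-sign (inj₁ e) = ¬∣⇒¬∣-in-ℤ[ζ] l prl (m ℕ.^ l) ¬l∣m^l t tt (trans (sym (×1#-homo-^ m l)) (trans (sym e) [-M]^l≈l×t))
      from-sign (inj₂ e) = ¬∣⇒¬∣-in-ℤ[ζ] l prl (m ℕ.^ l) ¬l∣m^l (- t) (Inℤ[ζ]-neg tt)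
        (trans (sym (×1#-homo-^ m l)) (trans (sym (⁻¹-involutive _)) (trans (-‿cong (trans (sym e) [-M]^l≈l×t)) (sym (×-neg l t)))))


module TransformAnalysis where

  open import Data.Nat as ℕ using (ℕ; zero; suc; _<_; _≤_; s≤s; z≤n; NonZero)
  import Data.Nat.Properties as ℕP
  open import Data.Nat.Divisibility as ℕD using (_∣_; _∣?_; divides)
  open import Data.Nat.DivMod using (_%_; _/_; m%n<n; m≡m%n+[m/n]*n; _mod_)
  import Data.Nat.DivMod as DM
  open import Data.Nat.Primality using (Prime)
  open import Data.Nat.ListAction using (product)
  open import Data.Nat.Primality.Factorisation using (factorise; PrimeFactorisation; factors)
  open import Data.List using (List; []; _∷_)
  open import Data.List.Relation.Unary.All using (All; []; _∷_)
  open import Data.Fin as Fin using (Fin; toℕ)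
  import Data.Fin.Properties as FP
  open import Data.Fin.Subset using (Subset; outside; inside)
  open import Data.Bool using () renaming (_≟_ to _≟ᵇ_)
  open import Data.Vec using (lookup)
  open import Data.Product using (Σ; _,_; proj₁; proj₂) renaming (_×_ to _&_)
  open import Data.Sum using (_⊎_; inj₁; inj₂)
  open import Data.Empty using (⊥-elim)
  open import Relation.Nullary using (¬_; yes; no; Dec)
  open import Relation.Binary.PropositionalEquality as P using (_≡_; _≢_)
  open import Algebra.Bundles using (CommutativeRing)
  open import Defs
  open FiniteSums
  open Arithmetic
  open CyclotomicIntegers
  open import Data.Nat.Solver using (module +-*-Solver)
  module NS = +-*-Solver

  ind≤1 : ∀ s → ind s ≤ 1
  ind≤1 inside = s≤s z≤n
  ind≤1 outside = z≤n

  ind-≢ : ∀ a b → a ≢ b → ind a ℕ.+ ind b ≡ 1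
  ind-≢ inside inside ne = ⊥-elim (ne P.refl)
  ind-≢ inside outside _ = P.refl
  ind-≢ outside inside _ = P.refl
  ind-≢ outside outside ne = ⊥-elim (ne P.refl)

  ΔU≤2 : ∀ {N} (X : Subset N) i → ΔU X i ≤ 2
  ΔU≤2 X i = ℕP.+-mono-≤ (ind≤1 (lookup X i)) (ind≤1 (lookup X (neg i)))

  neg-zero : ∀ {N} (i : Fin N) → toℕ i ≡ 0 → toℕ (neg i) ≡ 0
  neg-zero {suc N} Fin.zero _ = P.refl

  module Transform {c ℓ'} (R : CommutativeRing c ℓ') (char0 : Char0 R) (nzd : NoZeroDivisors R)
    (p α : ℕ) (pr : Prime p) (α≥1 : 1 ≤ α) (ζ : CommutativeRing.Carrier R) (prim : PrimitiveRoot R p α ζ)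
    (X : Subset (p ℕ.^ α))
    (m : ℕ) (m≥1 : 1 ≤ m)
    (FΔU∈0,negm : ∀ z → toℕ z ≢ 0 →
        CommutativeRing._≈_ R (FΔU R ζ X z) (CommutativeRing.0# R)
        ⊎ CommutativeRing._≈_ R (FΔU R ζ X z) (negConst R m)) where

    open CommutativeRing R
    open import Relation.Binary.Reasoning.Setoid setoid
    open import Algebra.Properties.Semiring.Exp semiring using (_^_; ^-homo-*; ^-congʳ)
    open import Algebra.Properties.Semiring.Mult semiring using (_×_; ×-homo-+; ×-congʳ; ×-congˡ; ×-assocˡ; ×-assoc-*; ×1-homo-*)
    open import Algebra.Solver.Ring.NaturalCoefficients.Default commutativeSemiring
    open import Algebra.Properties.Group +-group
      using (⁻¹-involutive; ε⁻¹≈ε) renaming (∙-cancelʳ to +-cancelʳ)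
    open import Algebra.Properties.Ring ring using (-‿distribˡ-*)
    open Cyclotomic R char0 nzd p α pr α≥1 ζ prim
    open PrimePower p pr

    instance
      m≢0 : NonZero m
      m≢0 = ℕ.>-nonZero m≥1

    Δ : ℕ → ℕ
    Δ i = ΔU X (i mod n)

    FΔ : ℕ → Carrier
    FΔ z = ∑ n (λ i → Δ i × ζ ^ (i ℕ.* z))

    mod-toℕ : ∀ (i : Fin n) → toℕ i mod n ≡ i
    mod-toℕ i = FP.toℕ-injective (P.trans (FP.toℕ-fromℕ< _) (DM.m<n⇒m%n≡m (FP.toℕ<n i)))

    toℕ-mod : ∀ a → toℕ (a mod n) ≡ a % n
    toℕ-mod a = FP.toℕ-fromℕ< _

    open import Algebra.Properties.Monoid.Sum +-monoid using (sum-cong-≗)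

    FΔU≈FΔ : ∀ (z : Fin n) → FΔU R ζ X z ≈ FΔ (toℕ z)
    FΔU≈FΔ z = trans (reflexive (sum-cong-≗ (λ i → P.cong (λ v → ΔU X v × ζ ^ (toℕ i ℕ.* toℕ z)) (P.sym (mod-toℕ i)))))
                    (sum≈∑ n (λ i → Δ i × ζ ^ (i ℕ.* toℕ z)))

    FΔ-modEq : ∀ {a b} → ModEq n a b → FΔ a ≈ FΔ b
    FΔ-modEq cg = ∑-cong n (λ i _ → ×-congʳ (Δ i) (ζ^-modEq (modEq-* i cg)))

    FΔ-% : ∀ a → FΔ (a % n) ≈ FΔ a
    FΔ-% a = FΔ-modEq (modEq-% n a)

    negm : Carrier
    negm = - (m × 1#)

    FΔU-mod≈FΔ : ∀ z → FΔU R ζ X (z mod n) ≈ FΔ z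
    FΔU-mod≈FΔ z = trans (FΔU≈FΔ (z mod n)) (trans (reflexive (P.cong FΔ (toℕ-mod z))) (FΔ-% z))

    FΔ∈0,negm : ∀ z → ¬ (n ∣ z) → FΔ z ≈ 0# ⊎ FΔ z ≈ negm
    FΔ∈0,negm z ¬n∣z with FΔU∈0,negm (z mod n) (λ e → ¬n∣z (ℕD.m%n≡0⇒n∣m z n (P.trans (P.sym (toℕ-mod z)) e)))
    ... | inj₁ e = inj₁ (trans (sym (FΔU-mod≈FΔ z)) e)
    ... | inj₂ e = inj₂ (trans (sym (FΔU-mod≈FΔ z)) e)

    ¬p∣prime : ∀ {l} → Prime l → l ≢ p → ¬ (p ∣ l)
    ¬p∣prime prl l≢p p∣l = l≢p (P.sym (prime∣prime pr prl p∣l))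

    FΔ-prime-dilation : ∀ l → Prime l → l ≢ p → ¬ (l ∣ m) → ∀ z → FΔ (l ℕ.* z) ≈ FΔ z
    FΔ-prime-dilation l prl l≢p ¬l∣m z with n ∣? z
    ... | yes (divides t z≡) = trans (FΔ-modEq cg1) (sym (FΔ-modEq cg0))
      where
      cg0 : ModEq n z 0
      cg0 = 0 , t , P.trans (ℕP.+-identityʳ z) z≡
      cg1 : ModEq n (l ℕ.* z) 0
      cg1 = 0 , l ℕ.* t , P.trans (ℕP.+-identityʳ _) (P.trans (P.cong (l ℕ.*_) z≡) (P.sym (ℕP.*-assoc l t n)))
    ... | no ¬n∣z = frobenius-rigid l prl m ¬l∣m (FΔ∈0,negm z ¬n∣z) (FΔ∈0,negm (l ℕ.* z) ¬n∣lz) frobenius-FΔ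
      where
      ¬n∣lz : ¬ (n ∣ l ℕ.* z)
      ¬n∣lz d = ¬n∣z (p^k∣u*x⇒p^k∣x (¬p∣prime prl l≢p) α z d)
      frobenius-FΔ : FΔ z ^ l ≡[ l ] FΔ (l ℕ.* z)
      frobenius-FΔ = ≡[]-trans (Frobenius.frobenius-∑ l prl n Δ (λ i → i ℕ.* z))
        (≡[]-reflexive (∑-cong n (λ i _ → ×-congʳ (Δ i) (^-congʳ ζ (P.trans (P.sym (ℕP.*-assoc l i z)) (P.trans (P.cong (ℕ._* z) (ℕP.*-comm l i)) (ℕP.*-assoc i l z)))))))

    Admissible : ℕ → Set
    Admissible ℓ = Prime ℓ & (ℓ ≢ p & ¬ (ℓ ∣ m))

    FΔ-product-dilation : ∀ as → All Admissible as → ∀ z → FΔ (product as ℕ.* z) ≈ FΔ z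
    FΔ-product-dilation [] [] z = reflexive (P.cong FΔ (ℕP.*-identityˡ z))
    FΔ-product-dilation (a ∷ as) ((pra , a≢p , ¬a∣m) ∷ g) z =
      trans (reflexive (P.cong FΔ (ℕP.*-assoc a (product as) z)))
       (trans (FΔ-prime-dilation a pra a≢p ¬a∣m (product as ℕ.* z)) (FΔ-product-dilation as g z))

    all-admissible : ∀ as → All Prime as → (∀ ℓ → Prime ℓ → ℓ ∣ product as → ℓ ≢ p & ¬ (ℓ ∣ m)) → All Admissible as
    all-admissible [] [] h = []
    all-admissible (a ∷ as) (pa ∷ ps) h = (pa , h a pa (ℕD.m∣m*n (product as))) ∷ all-admissible as ps (λ ℓ pℓ d → h ℓ pℓ (ℕD.∣n⇒∣m*n a d))

    p∣n : p ∣ n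
    p∣n = divides q (P.trans n≡pq (ℕP.*-comm p q))

    FΔ-unit-dilation : ∀ k → ¬ (p ∣ k) → ∀ z → FΔ (k ℕ.* z) ≈ FΔ z
    FΔ-unit-dilation k ¬p∣k z with coprime-representative n p∣n (λ ℓ prℓ d → prime∣p^⇒≡p prℓ α d) m k ¬p∣k
    ... | k' , k'≢0 , cg , good = trans (FΔ-modEq cgz) (trans (reflexive (P.cong (λ v → FΔ (v ℕ.* z)) (PrimeFactorisation.isFactorisation fk)))
                                     (FΔ-product-dilation (factors fk) (all-admissible (factors fk) (PrimeFactorisation.factorsPrime fk) h) z))
      where
      cgz : ModEq n (k ℕ.* z) (k' ℕ.* z)
      cgz = P.subst₂ (ModEq n) (ℕP.*-comm z k) (ℕP.*-comm z k') (modEq-* z cg)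
      fk = factorise k' {{ℕ.≢-nonZero k'≢0}}
      h : ∀ ℓ → Prime ℓ → ℓ ∣ product (factors fk) → ℓ ≢ p & ¬ (ℓ ∣ m)
      h ℓ prℓ d = good ℓ prℓ (P.subst (ℓ ∣_) (P.sym (PrimeFactorisation.isFactorisation fk)) d)

    FΔ-valuation : ∀ z s u → z ≡ p ℕ.^ s ℕ.* u → ¬ (p ∣ u) → FΔ z ≈ FΔ (p ℕ.^ s)
    FΔ-valuation z s u z≡ ¬p∣u = trans (reflexive (P.cong FΔ (P.trans z≡ (ℕP.*-comm (p ℕ.^ s) u)))) (FΔ-unit-dilation u ¬p∣u (p ℕ.^ s))

    Φ : ℕ → Carrier
    Φ e = FΔ (p ℕ.^ e)

    ∂Φ : ℕ → Carrier
    ∂Φ zero = Φ 0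
    ∂Φ (suc e) = Φ (suc e) + - Φ e

    ∑∂Φ≈Φ : ∀ s → ∑ (suc s) ∂Φ ≈ Φ s
    ∑∂Φ≈Φ zero = +-identityʳ _
    ∑∂Φ≈Φ (suc s) = begin
      ∑ (suc (suc s)) ∂Φ                 ≈⟨ ∑-last (suc s) ∂Φ ⟩
      ∑ (suc s) ∂Φ + ∂Φ (suc s)           ≈⟨ +-congʳ (∑∂Φ≈Φ s) ⟩
      Φ s + (Φ (suc s) + - Φ s)         ≈⟨ +-comm _ _ ⟩
      (Φ (suc s) + - Φ s) + Φ s         ≈⟨ +-assoc _ _ _ ⟩
      Φ (suc s) + (- Φ s + Φ s)         ≈⟨ +-congˡ (-‿inverseˡ _) ⟩
      Φ (suc s) + 0#                    ≈⟨ +-identityʳ _ ⟩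
      Φ (suc s) ∎

    ∂Φ-if : ℕ → ℕ → Carrier
    ∂Φ-if e z = ite (p ℕ.^ e ∣? z) (∂Φ e) 0#

    ∑∂Φ-if-truncate : ∀ z s → s ≤ α → (∀ e → e ≤ α → (p ℕ.^ e ∣ z → e ≤ s) & (e ≤ s → p ℕ.^ e ∣ z)) →
            ∑ (suc α) (λ e → ∂Φ-if e z) ≈ ∑ (suc s) ∂Φ
    ∑∂Φ-if-truncate z s s≤α h = begin
      ∑ (suc α) (λ e → ∂Φ-if e z)   ≡⟨ P.cong (λ v → ∑ v (λ e → ∂Φ-if e z)) eqα ⟩
      ∑ (suc s ℕ.+ (α ℕ.∸ s)) (λ e → ∂Φ-if e z) ≈⟨ ∑-split (suc s) (α ℕ.∸ s) (λ e → ∂Φ-if e z) ⟩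
      ∑ (suc s) (λ e → ∂Φ-if e z) + ∑ (α ℕ.∸ s) (λ i → ∂Φ-if (suc s ℕ.+ i) z)
        ≈⟨ +-cong (∑-cong (suc s) first) (∑-≈0# (α ℕ.∸ s) (λ i → ∂Φ-if (suc s ℕ.+ i) z) second) ⟩
      ∑ (suc s) ∂Φ + 0#            ≈⟨ +-identityʳ _ ⟩
      ∑ (suc s) ∂Φ ∎
      where
      eqα : suc α ≡ suc s ℕ.+ (α ℕ.∸ s)
      eqα = P.cong suc (P.sym (ℕP.m+[n∸m]≡n s≤α))
      first : ∀ e → e < suc s → ∂Φ-if e z ≈ ∂Φ e
      first e (s≤s e≤s) with p ℕ.^ e ∣? z
      ... | yes _ = refl
      ... | no ¬d = ⊥-elim (¬d (proj₂ (h e (ℕP.≤-trans e≤s s≤α)) e≤s))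
      second : ∀ i → i < α ℕ.∸ s → ∂Φ-if (suc s ℕ.+ i) z ≈ 0#
      second i i< with p ℕ.^ (suc s ℕ.+ i) ∣? z
      ... | no _ = refl
      ... | yes dv = ⊥-elim (ℕP.<⇒≱ (s≤s (ℕP.m≤m+n s i)) (proj₁ (h (suc s ℕ.+ i) le) dv))
        where
        le : suc s ℕ.+ i ≤ α
        le = P.subst (suc s ℕ.+ i ≤_) (ℕP.m+[n∸m]≡n s≤α) (ℕP.+-monoʳ-< s i<)

    FΔ-layers : ∀ z → z < n → FΔ z ≈ ∑ (suc α) (λ e → ∂Φ-if e z)
    FΔ-layers zero _ = trans (FΔ-modEq (1 , 0 , P.trans (ℕP.*-identityˡ n) (P.sym (ℕP.+-identityʳ n)))) (trans (sym (∑∂Φ≈Φ α)) (sym (∑∂Φ-if-truncate 0 α ℕP.≤-refl (λ e e≤α → (λ _ → e≤α) , (λ _ → divides 0 P.refl)))))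
    FΔ-layers (suc z') z<n with p-adic-split (suc z') (λ ())
    ... | s , u , z≡ , ¬p∣u = trans (FΔ-valuation z s u z≡ ¬p∣u) (trans (sym (∑∂Φ≈Φ s)) (sym (∑∂Φ-if-truncate z s (ℕP.<⇒≤ s<α) h)))
      where
      z = suc z'
      u≢0 : u ≢ 0
      u≢0 u≡0 = ℕP.1+n≢0 (P.trans z≡ (P.trans (P.cong (p ℕ.^ s ℕ.*_) u≡0) (ℕP.*-zeroʳ (p ℕ.^ s))))
      s<α : s < α
      s<α = p^s*u<p^a⇒s<a s u α u≢0 (P.subst (_< n) z≡ z<n)
      h : ∀ e → e ≤ α → (p ℕ.^ e ∣ z → e ≤ s) & (e ≤ s → p ℕ.^ e ∣ z)
      h e _ = (λ dv → p^e∣p^s*u⇒e≤s ¬p∣u e s (P.subst (p ℕ.^ e ∣_) z≡ dv)) , (λ e≤s → P.subst (p ℕ.^ e ∣_) (P.sym z≡) (e≤s⇒p^e∣p^s*u u e s e≤s))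

    FΔ-dual : ℕ → Carrier
    FΔ-dual w = ∑ n (λ z → FΔ z * ζ ^ (z ℕ.* w))

    p^e*p^[α∸e]≡n : ∀ e → e ≤ α → p ℕ.^ e ℕ.* p ℕ.^ (α ℕ.∸ e) ≡ n
    p^e*p^[α∸e]≡n e e≤α = P.trans (P.sym (ℕP.^-distribˡ-+-* p e (α ℕ.∸ e))) (P.cong (p ℕ.^_) (ℕP.m+[n∸m]≡n e≤α))

    FΔ-dual-layers : ∀ w → FΔ-dual w ≈ ∑ (suc α) (λ e → ∂Φ e * ite (p ℕ.^ (α ℕ.∸ e) ∣? w) ((p ℕ.^ (α ℕ.∸ e)) × 1#) 0#)
    FΔ-dual-layers w = begin
      FΔ-dual w
        ≈⟨ ∑-cong n (λ z z<n → *-congʳ (FΔ-layers z z<n)) ⟩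
      ∑ n (λ z → ∑ (suc α) (λ e → ∂Φ-if e z) * ζ ^ (z ℕ.* w))
        ≈⟨ ∑-cong n (λ z _ → *-distribʳ-∑ (suc α) (ζ ^ (z ℕ.* w)) (λ e → ∂Φ-if e z)) ⟩
      ∑ n (λ z → ∑ (suc α) (λ e → ∂Φ-if e z * ζ ^ (z ℕ.* w)))
        ≈⟨ ∑-comm n (suc α) (λ z e → ∂Φ-if e z * ζ ^ (z ℕ.* w)) ⟩
      ∑ (suc α) (λ e → ∑ n (λ z → ∂Φ-if e z * ζ ^ (z ℕ.* w)))
        ≈⟨ ∑-cong (suc α) (λ e e<  → trans (∑-cong n (λ z _ → pt e z)) (trans (sym (*-distribˡ-∑ n (∂Φ e) _))
                (*-congˡ (orthogonality-on-multiples (p ℕ.^ e) (p ℕ.^ (α ℕ.∸ e)) (p^e*p^[α∸e]≡n e (ℕP.≤-pred e<)) (p^>0 e) w)))) ⟩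
      ∑ (suc α) (λ e → ∂Φ e * ite (p ℕ.^ (α ℕ.∸ e) ∣? w) ((p ℕ.^ (α ℕ.∸ e)) × 1#) 0#) ∎
      where
      pt : ∀ e z → ∂Φ-if e z * ζ ^ (z ℕ.* w) ≈ ∂Φ e * ite (p ℕ.^ e ∣? z) (ζ ^ (z ℕ.* w)) 0#
      pt e z with p ℕ.^ e ∣? z
      ... | yes _ = refl
      ... | no _ = trans (zeroˡ _) (sym (zeroʳ _))

    Δ-% : ∀ j → Δ (j % n) ≡ Δ j
    Δ-% j = P.cong (ΔU X) (FP.toℕ-injective (P.trans (toℕ-mod (j % n)) (P.trans (DM.m%n%n≡m%n j n) (P.sym (toℕ-mod j)))))

    fourier-inversion : ∀ j → FΔ-dual (n ℕ.∸ (j % n)) ≈ (n ℕ.* Δ j) × 1#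
    fourier-inversion j = begin
      FΔ-dual w
        ≈⟨ ∑-cong n (λ z _ → trans (*-distribʳ-∑ n _ _) (∑-cong n (λ i _ → trans (×-assoc-* (Δ i) _ _) (×-congʳ (Δ i) (pj z i))))) ⟩
      ∑ n (λ z → ∑ n (λ i → Δ i × ζ ^ (z ℕ.* (i ℕ.+ w))))
        ≈⟨ ∑-comm n n _ ⟩
      ∑ n (λ i → ∑ n (λ z → Δ i × ζ ^ (z ℕ.* (i ℕ.+ w))))
        ≈⟨ ∑-cong n (λ i i<n → trans (sym (×-distrib-∑ n (Δ i) _)) (trans (×-congʳ (Δ i) (orthogonality (i ℕ.+ w))) (pt i i<n))) ⟩
      ∑ n (λ i → ite (r ℕ.≟ i) (Δ i × (n × 1#)) 0#)
        ≈⟨ ∑-δ n r (λ i → Δ i × (n × 1#)) r<n ⟩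
      Δ r × (n × 1#)
        ≈⟨ ×-assocˡ 1# (Δ r) n ⟩
      (Δ r ℕ.* n) × 1#
        ≡⟨ P.cong (λ v → v × 1#) (P.trans (P.cong (ℕ._* n) (Δ-% j)) (ℕP.*-comm (Δ j) n)) ⟩
      (n ℕ.* Δ j) × 1# ∎
      where
      r = j % n
      r<n = m%n<n j n
      w = n ℕ.∸ r
      pj : ∀ z i → ζ ^ (i ℕ.* z) * ζ ^ (z ℕ.* w) ≈ ζ ^ (z ℕ.* (i ℕ.+ w))
      pj z i = trans (sym (^-homo-* ζ (i ℕ.* z) (z ℕ.* w))) (^-congʳ ζ (P.trans (P.cong (ℕ._+ z ℕ.* w) (ℕP.*-comm i z)) (P.sym (ℕP.*-distribˡ-+ z i w))))
      pt : ∀ i → i < n → Δ i × ite (n ∣? (i ℕ.+ w)) (n × 1#) 0# ≈ ite (r ℕ.≟ i) (Δ i × (n × 1#)) 0#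
      pt i i<n with n ∣? (i ℕ.+ w) | r ℕ.≟ i
      ... | yes _ | yes _ = refl
      ... | no _ | no _ = ×-0# (Δ i)
      ... | yes x | no y = ⊥-elim (y (n∣i+[n∸r]⇒r≡i i r i<n r<n x))
      ... | no x | yes P.refl = ⊥-elim (x (P.subst (n ∣_) (P.sym (ℕP.m+[n∸m]≡n (ℕP.<⇒≤ r<n))) ℕD.∣-refl))

    Pe : ℕ → ℕ
    Pe e = p ℕ.^ (α ℕ.∸ e)

    layer-sum : ℕ → Carrier
    layer-sum j = ∑ (suc α) (λ e → ∂Φ e * ite (Pe e ∣? j) (Pe e × 1#) 0#)

    Δ-layers : ∀ j → (n ℕ.* Δ j) × 1# ≈ layer-sum j
    Δ-layers j = trans (sym (fourier-inversion j)) (trans (FΔ-dual-layers (n ℕ.∸ (j % n))) (∑-cong (suc α) (λ e e< → *-congˡ {∂Φ e} (pt e (ℕP.≤-pred e<)))))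
      where
      pt : ∀ e → e ≤ α → ite (Pe e ∣? (n ℕ.∸ (j % n))) (Pe e × 1#) 0# ≈ ite (Pe e ∣? j) (Pe e × 1#) 0#
      pt e e≤α with Pe e ∣? (n ℕ.∸ (j % n)) | Pe e ∣? j
      ... | yes _ | yes _ = refl
      ... | no _ | no _ = refl
      ... | yes x | no y = ⊥-elim (y (proj₁ (∣n⇒[∣n∸j%n⇔∣j] (p^-mono-∣ (ℕP.m∸n≤m α e)) j) x))
      ... | no x | yes y = ⊥-elim (x (proj₂ (∣n⇒[∣n∸j%n⇔∣j] (p^-mono-∣ (ℕP.m∸n≤m α e)) j) y))

    g : ℕ → ℕ
    g u = Δ (Pe u)

    layer-tail : ℕ → Carrier
    layer-tail u = ∑ (suc α) (λ e → ite (u ℕ.≤? e) (∂Φ e * (Pe e × 1#)) 0#)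

    Pe∣Pe⇔≤ : ∀ u e → u ≤ α → e ≤ α → (Pe e ∣ Pe u → u ≤ e) & (u ≤ e → Pe e ∣ Pe u)
    Pe∣Pe⇔≤ u e u≤α e≤α = to , (λ u≤e → p^-mono-∣ (ℕP.∸-monoʳ-≤ α u≤e))
      where
      to : Pe e ∣ Pe u → u ≤ e
      to dv with u ℕ.≤? e
      ... | yes x = x
      ... | no ¬x = ⊥-elim (ℕP.<⇒≱ (ℕP.∸-monoʳ-< (ℕP.≰⇒> ¬x) u≤α) le)
        where
        le : α ℕ.∸ e ≤ α ℕ.∸ u
        le = p^e∣p^s*u⇒e≤s (λ p∣1 → ℕP.<⇒≱ (prime≥2 pr) (ℕD.∣⇒≤ p∣1)) (α ℕ.∸ e) (α ℕ.∸ u) (P.subst (Pe e ∣_) (P.sym (ℕP.*-identityʳ _)) dv)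

    g≈layer-tail : ∀ u → u ≤ α → (n ℕ.* g u) × 1# ≈ layer-tail u
    g≈layer-tail u u≤α = trans (Δ-layers (Pe u)) (∑-cong (suc α) (λ e e< → pt e (ℕP.≤-pred e<)))
      where
      pt : ∀ e → e ≤ α → ∂Φ e * ite (Pe e ∣? Pe u) (Pe e × 1#) 0# ≈ ite (u ℕ.≤? e) (∂Φ e * (Pe e × 1#)) 0#
      pt e e≤α with Pe e ∣? Pe u | u ℕ.≤? e
      ... | yes _ | yes _ = refl
      ... | no _ | no _ = zeroʳ _
      ... | yes x | no y = ⊥-elim (y (proj₁ (Pe∣Pe⇔≤ u e u≤α e≤α) x))
      ... | no x | yes y = ⊥-elim (x (proj₂ (Pe∣Pe⇔≤ u e u≤α e≤α) y))

    layer-tail-step : ∀ u → u < α → layer-tail u ≈ ∂Φ u * (Pe u × 1#) + layer-tail (suc u)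
    layer-tail-step u u<α = trans (∑-cong (suc α) (λ e _ → pt e)) (trans (∑-distrib-+ (suc α) (λ e → ite (u ℕ.≟ e) (∂Φ e * (Pe e × 1#)) 0#) (λ e → ite (suc u ℕ.≤? e) (∂Φ e * (Pe e × 1#)) 0#))
                       (+-congʳ (∑-δ (suc α) u (λ e → ∂Φ e * (Pe e × 1#)) (s≤s (ℕP.<⇒≤ u<α)))))
      where
      pt : ∀ e → ite (u ℕ.≤? e) (∂Φ e * (Pe e × 1#)) 0# ≈ ite (u ℕ.≟ e) (∂Φ e * (Pe e × 1#)) 0# + ite (suc u ℕ.≤? e) (∂Φ e * (Pe e × 1#)) 0#
      pt e with u ℕ.≤? e | u ℕ.≟ e | suc u ℕ.≤? e
      ... | yes _ | yes P.refl | yes x = ⊥-elim (ℕP.<-irrefl P.refl x)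
      ... | yes _ | yes _ | no _ = sym (+-identityʳ _)
      ... | yes _ | no _ | yes _ = sym (+-identityˡ _)
      ... | yes a | no b | no c = ⊥-elim (c (ℕP.≤∧≢⇒< a b))
      ... | no a | yes P.refl | _ = ⊥-elim (a ℕP.≤-refl)
      ... | no a | no _ | yes c = ⊥-elim (a (ℕP.<⇒≤ c))
      ... | no _ | no _ | no _ = sym (+-identityʳ _)

    g-step : ∀ u → u < α → (n ℕ.* g u) × 1# ≈ ∂Φ u * (Pe u × 1#) + (n ℕ.* g (suc u)) × 1#
    g-step u u<α = trans (g≈layer-tail u (ℕP.<⇒≤ u<α)) (trans (layer-tail-step u u<α) (+-congˡ (sym (g≈layer-tail (suc u) u<α))))

    p^e<n : ∀ e → e < α → p ℕ.^ e < n
    p^e<n e e<α = ℕP.^-monoʳ-< p (prime≥2 pr) e<α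

    ¬n∣p^e : ∀ {e} → e < α → ¬ (n ∣ p ℕ.^ e)
    ¬n∣p^e {e} e<α dv = ℕP.<⇒≢ (p^>0 e) (P.sym (n∣x<n⇒x≡0 (p ℕ.^ e) (p^e<n e e<α) dv))

    γ : ℕ → ℕ
    γ e with e ℕ.<? α
    ... | no _ = 0
    ... | yes e<α with FΔ∈0,negm (p ℕ.^ e) (¬n∣p^e e<α)
    ...   | inj₁ _ = 0
    ...   | inj₂ _ = 1

    Φ≈-γm : ∀ e → e < α → Φ e ≈ - ((γ e ℕ.* m) × 1#)
    Φ≈-γm e e<α with e ℕ.<? α
    ... | no ¬x = ⊥-elim (¬x e<α)
    ... | yes x with FΔ∈0,negm (p ℕ.^ e) (¬n∣p^e x)
    ...   | inj₁ z = trans z (sym ε⁻¹≈ε)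
    ...   | inj₂ z = trans z (-‿cong (×-congˡ (P.sym (ℕP.*-identityˡ m))))

    γ≤1 : ∀ e → γ e ≤ 1
    γ≤1 e with e ℕ.<? α
    ... | no _ = z≤n
    ... | yes e<α with FΔ∈0,negm (p ℕ.^ e) (¬n∣p^e e<α)
    ...   | inj₁ _ = z≤n
    ...   | inj₂ _ = s≤s z≤n

    ι : ℕ → Carrier
    ι a = a × 1#

    ∂Φ≈γ : ∀ u → u < α → ∂Φ u ≈ - ι (γ u ℕ.* m) + ι (delay γ u ℕ.* m)
    ∂Φ≈γ zero u<α = trans (Φ≈-γm 0 u<α) (sym (+-identityʳ _))
    ∂Φ≈γ (suc u) u<α = +-cong (Φ≈-γm (suc u) u<α) (trans (-‿cong (Φ≈-γm u (ℕP.<-trans (ℕP.n<1+n u) u<α))) (⁻¹-involutive _))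

    recurrence-scaled : ∀ u → u < α → n ℕ.* g u ℕ.+ γ u ℕ.* m ℕ.* Pe u ≡ delay γ u ℕ.* m ℕ.* Pe u ℕ.+ n ℕ.* g (suc u)
    recurrence-scaled u u<α = ×1#-injective _ _ (begin
      ι (n ℕ.* g u ℕ.+ γ u ℕ.* m ℕ.* Pe u)   ≈⟨ ×-homo-+ 1# (n ℕ.* g u) _ ⟩
      A + x                                   ≈⟨ +-congʳ (g-step u u<α) ⟩
      (∂Φ u * ι (Pe u) + B) + x                ≈⟨ +-congʳ (+-congʳ (trans (*-congʳ (∂Φ≈γ u u<α)) (distribʳ _ _ _))) ⟩
      ((- ι (γ u ℕ.* m) * ι (Pe u) + ι (delay γ u ℕ.* m) * ι (Pe u)) + B) + x
          ≈⟨ +-congʳ (+-congʳ (+-cong (trans (sym (-‿distribˡ-* _ _)) (-‿cong (sym (×1-homo-* (γ u ℕ.* m) (Pe u))))) (sym (×1-homo-* (delay γ u ℕ.* m) (Pe u))))) ⟩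
      ((- x + y) + B) + x                     ≈⟨ solve 4 (λ a b c d → ((a :+ b) :+ c) :+ d := (b :+ c) :+ (a :+ d)) refl (- x) y B x ⟩
      (y + B) + (- x + x)                     ≈⟨ +-congˡ (-‿inverseˡ x) ⟩
      (y + B) + 0#                            ≈⟨ +-identityʳ _ ⟩
      y + B                                   ≈⟨ sym (×-homo-+ 1# (delay γ u ℕ.* m ℕ.* Pe u) (n ℕ.* g (suc u))) ⟩
      ι (delay γ u ℕ.* m ℕ.* Pe u ℕ.+ n ℕ.* g (suc u)) ∎)
      where
      A = ι (n ℕ.* g u)
      B = ι (n ℕ.* g (suc u))
      x = ι (γ u ℕ.* m ℕ.* Pe u)
      y = ι (delay γ u ℕ.* m ℕ.* Pe u)

    recurrence : ∀ u → u < α → p ℕ.^ u ℕ.* g u ℕ.+ γ u ℕ.* m ≡ delay γ u ℕ.* m ℕ.+ p ℕ.^ u ℕ.* g (suc u)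
    recurrence u u<α = ℕP.*-cancelˡ-≡ _ _ (Pe u) {{p^-nonZero (α ℕ.∸ u)}}
      (P.trans (NS.solve 5 (λ a b c d e → a NS.:* (b NS.:* c NS.:+ d NS.:* e) NS.:= b NS.:* a NS.:* c NS.:+ d NS.:* e NS.:* a) P.refl (Pe u) (p ℕ.^ u) (g u) (γ u) m)
      (P.trans (P.cong (λ v → v ℕ.* g u ℕ.+ γ u ℕ.* m ℕ.* Pe u) (p^e*p^[α∸e]≡n u (ℕP.<⇒≤ u<α)))
      (P.trans (recurrence-scaled u u<α)
      (P.trans (P.cong (λ v → delay γ u ℕ.* m ℕ.* Pe u ℕ.+ v ℕ.* g (suc u)) (P.sym (p^e*p^[α∸e]≡n u (ℕP.<⇒≤ u<α))))
      (NS.solve 5 (λ a b c d e → d NS.:* e NS.:* a NS.:+ b NS.:* a NS.:* c NS.:= a NS.:* (d NS.:* e NS.:+ b NS.:* c)) P.refl (Pe u) (p ℕ.^ u) (g (suc u)) (delay γ u) m)))))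

    Δ-valuation : ∀ j → j < n → ∀ t u → j ≡ p ℕ.^ t ℕ.* u → ¬ (p ∣ u) → t ≤ α → Δ j ≡ g (α ℕ.∸ t)
    Δ-valuation j j<n t u j≡ ¬p∣u t≤α = ℕP.*-cancelˡ-≡ _ _ n (×1#-injective _ _ (trans (Δ-layers j) (trans (∑-cong (suc α) (λ e e< → *-congˡ {∂Φ e} (pt e (ℕP.≤-pred e<))))
                                      (trans (reflexive (P.cong layer-sum (P.cong (p ℕ.^_) (P.sym (ℕP.m∸[m∸n]≡n t≤α))))) (sym (Δ-layers (Pe (α ℕ.∸ t))))))))
      where
      pt : ∀ e → e ≤ α → ite (Pe e ∣? j) (Pe e × 1#) 0# ≈ ite (Pe e ∣? (p ℕ.^ t)) (Pe e × 1#) 0#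
      pt e _ with Pe e ∣? j | Pe e ∣? (p ℕ.^ t)
      ... | yes _ | yes _ = refl
      ... | no _ | no _ = refl
      ... | yes x | no y = ⊥-elim (y (p^-mono-∣ (p^e∣p^s*u⇒e≤s ¬p∣u (α ℕ.∸ e) t (P.subst (Pe e ∣_) j≡ x))))
      ... | no x | yes y = ⊥-elim (x (P.subst (Pe e ∣_) (P.sym j≡) (ℕD.∣m⇒∣m*n u y)))

    module Conclusion (0∉X : ∀ i → toℕ i ≡ 0 → lookup X i ≡ outside)
                 (X≢-X : ¬ (∀ i → lookup X i ≡ lookup X (neg i)))
                 (β : ℕ) (β-min : IsMinValOnΓ R p α ζ X m β)
                 (p≢2 : p ≢ 2) where

      ΔU-zero : ∀ i → toℕ i ≡ 0 → ΔU X i ≡ 0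
      ΔU-zero i e rewrite 0∉X i e | 0∉X (neg i) (neg-zero i e) = P.refl

      Δ-toℕ : ∀ (i : Fin n) → Δ (toℕ i) ≡ ΔU X i
      Δ-toℕ i = P.cong (ΔU X) (mod-toℕ i)

      g0≡0 : g 0 ≡ 0
      g0≡0 = ΔU-zero (n mod n) (P.trans (toℕ-mod n) (DM.n%n≡0 n))

      p≥3 : 3 ≤ p
      p≥3 = ℕP.≤∧≢⇒< (prime≥2 pr) (λ e → p≢2 (P.sym e))

      -ι-injective : ∀ a b → - ι a ≈ - ι b → a ≡ b
      -ι-injective a b e = ×1#-injective a b (trans (sym (⁻¹-involutive _)) (trans (-‿cong e) (⁻¹-involutive _)))

      FΔ0≈ι∑Δ : FΔ 0 ≈ ι (∑ℕ.∑ n Δ)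
      FΔ0≈ι∑Δ = trans (∑-cong n (λ i _ → ×-congʳ (Δ i) (^-congʳ ζ (ℕP.*-zeroʳ i)))) (sym (×-homo-∑ℕ n Δ 1#))

      FΔ0≉negm : ¬ (FΔ 0 ≈ negm)
      FΔ0≉negm e = ℕP.<⇒≢ m≥1 (P.sym (ℕP.m+n≡0⇒n≡0 (∑ℕ.∑ n Δ) (char0 _ lem)))
        where
        lem : ι (∑ℕ.∑ n Δ ℕ.+ m) ≈ 0#
        lem = trans (×-homo-+ 1# (∑ℕ.∑ n Δ) m) (trans (+-congʳ (trans (sym FΔ0≈ι∑Δ) e)) (-‿inverseˡ _))

      γ≡1⇒Φ≈negm : ∀ u → u < α → γ u ≡ 1 → Φ u ≈ negm
      γ≡1⇒Φ≈negm u u<α e = trans (Φ≈-γm u u<α) (-‿cong (×-congˡ (P.trans (P.cong (ℕ._* m) e) (ℕP.*-identityˡ m))))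

      Φ≈negm⇒γ≡1 : ∀ u → u < α → Φ u ≈ negm → γ u ≡ 1
      Φ≈negm⇒γ≡1 u u<α e with γ u | γ≤1 u | Φ≈-γm u u<α
      ... | suc zero | _ | _ = P.refl
      ... | zero | _ | x = ⊥-elim (ℕP.<⇒≢ m≥1 (-ι-injective 0 m (trans (sym x) e)))
      ... | suc (suc _) | s≤s () | _

      isValuation : ∀ (z : Fin n) t u → toℕ z ≡ p ℕ.^ t ℕ.* u → ¬ (p ∣ u) → t ≤ α → IsValuation p α z t
      isValuation z t u e ¬p∣u t≤α = t≤α , P.subst (p ℕ.^ t ∣_) (P.sym e) (ℕD.m∣m*n u) ,
        λ k _ dv → p^e∣p^s*u⇒e≤s ¬p∣u k t (P.subst (p ℕ.^ k ∣_) e dv)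

      valuation-unique : ∀ (z : Fin n) t u j → toℕ z ≡ p ℕ.^ t ℕ.* u → ¬ (p ∣ u) → t ≤ α → IsValuation p α z j → j ≡ t
      valuation-unique z t u j e ¬p∣u t≤α (j≤α , pj∣ , mx) =
        ℕP.≤-antisym (p^e∣p^s*u⇒e≤s ¬p∣u j t (P.subst (p ℕ.^ j ∣_) e pj∣)) (mx t t≤α (P.subst (p ℕ.^ t ∣_) (P.sym e) (ℕD.m∣m*n u)))

      record ValuationData (i : Fin n) : Set where
        field
          t u : ℕ
          teq : toℕ i ≡ p ℕ.^ t ℕ.* u
          ¬p∣u : ¬ (p ∣ u)
          t<α : t < α
          Δeq : ΔU X i ≡ g (α ℕ.∸ t)

      valuationData : ∀ (i : Fin n) → toℕ i ≢ 0 → ValuationData i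
      valuationData i ne with p-adic-split (toℕ i) ne
      ... | t , u , e , ¬p∣u = record { t = t ; u = u ; teq = e ; ¬p∣u = ¬p∣u ; t<α = t<α ;
                                 Δeq = P.trans (P.sym (Δ-toℕ i)) (Δ-valuation (toℕ i) (FP.toℕ<n i) t u e ¬p∣u (ℕP.<⇒≤ t<α)) }
        where
        t<α : t < α
        t<α = p^s*u<p^a⇒s<a t u α (λ u≡0 → ne (P.trans e (P.trans (P.cong (p ℕ.^ t ℕ.*_) u≡0) (ℕP.*-zeroʳ (p ℕ.^ t))))) (P.subst (_< n) e (FP.toℕ<n i))

      z0 : Fin n
      z0 = proj₁ (proj₁ β-min)

      FΔz0≈negm : FΔ (toℕ z0) ≈ negm
      FΔz0≈negm = trans (sym (FΔU≈FΔ z0)) (proj₁ (proj₂ (proj₁ β-min)))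

      z0≢0 : toℕ z0 ≢ 0
      z0≢0 e = FΔ0≉negm (trans (reflexive (P.cong FΔ (P.sym e))) FΔz0≈negm)

      open ValuationData (valuationData z0 z0≢0) using ()
        renaming (t to s0; u to u0; teq to eq0; ¬p∣u to ¬p∣u0; t<α to s0<α)

      β≡s0 : β ≡ s0
      β≡s0 = valuation-unique z0 s0 u0 β eq0 ¬p∣u0 (ℕP.<⇒≤ s0<α) (proj₂ (proj₂ (proj₁ β-min)))

      β<α : β < α
      β<α = P.subst (_< α) (P.sym β≡s0) s0<α

      γβ : γ β ≡ 1
      γβ = P.subst (λ v → γ v ≡ 1) (P.sym β≡s0) (Φ≈negm⇒γ≡1 s0 s0<α (trans (sym (FΔ-valuation (toℕ z0) s0 u0 eq0 ¬p∣u0)) FΔz0≈negm))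

      γ<β : ∀ u → u < β → γ u ≡ 0
      γ<β u u<β with γ u in eγ | γ≤1 u
      ... | zero | _ = P.refl
      ... | suc (suc _) | s≤s ()
      ... | suc zero | _ = ⊥-elim (ℕP.<⇒≱ u<β (proj₂ β-min zf u Fzf vzf))
        where
        u<α = ℕP.<-trans u<β β<α
        zf = (p ℕ.^ u) mod n
        tz : toℕ zf ≡ p ℕ.^ u
        tz = P.trans (toℕ-mod _) (DM.m<n⇒m%n≡m (p^e<n u u<α))
        Fzf : FΔU R ζ X zf ≈ negConst R m
        Fzf = trans (FΔU≈FΔ zf) (trans (reflexive (P.cong FΔ tz)) (γ≡1⇒Φ≈negm u u<α eγ))
        vzf : IsValuation p α zf u
        vzf = isValuation zf u 1 (P.trans tz (P.sym (ℕP.*-identityʳ _))) (λ p∣1 → ℕP.<⇒≱ (prime≥2 pr) (ℕD.∣⇒≤ p∣1)) (ℕP.<⇒≤ u<α)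

      open ValuationRecurrence p α m β g γ p≥3 m≥1 β<α γβ γ<β γ≤1 (λ u → ΔU≤2 X _) g0≡0 recurrence

      g-dichotomy : ∀ v → v ≤ α → (v ≤ β & g v ≡ 0) ⊎ (β < v & g v ≡ g-top)
      g-dichotomy v v≤α with v ℕ.≤? β
      ... | yes v≤β = inj₁ (v≤β , g≡0-upto-β v v≤β)
      ... | no ¬v≤β = inj₂ (ℕP.≰⇒> ¬v≤β , g≡g-top-above-β v (ℕP.≰⇒> ¬v≤β) v≤α)

      g-top≡1 : g-top ≡ 1
      g-top≡1 with FP.¬∀⟶∃¬ n (λ i → lookup X i ≡ lookup X (neg i)) (λ i → lookup X i ≟ᵇ lookup X (neg i)) X≢-X
      ... | i , ne = by-dichotomy (g-dichotomy v (ℕP.m∸n≤m α (ValuationData.t vi)))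
        where
        i≢0 : toℕ i ≢ 0
        i≢0 e = ne (P.trans (0∉X i e) (P.sym (0∉X (neg i) (neg-zero i e))))
        vi = valuationData i i≢0
        Δ1 : ΔU X i ≡ 1
        Δ1 = ind-≢ _ _ ne
        v = α ℕ.∸ ValuationData.t vi
        by-dichotomy : (v ≤ β & g v ≡ 0) ⊎ (β < v & g v ≡ g-top) → g-top ≡ 1
        by-dichotomy (inj₁ (_ , g0')) = ⊥-elim (ℕP.1+n≢0 (P.trans (P.sym Δ1) (P.trans (ValuationData.Δeq vi) g0')))
        by-dichotomy (inj₂ (_ , gc)) = P.trans (P.sym gc) (P.trans (P.sym (ValuationData.Δeq vi)) Δ1)

      α∸-flip : ∀ {a b} → a ≤ α → b ≤ α → α ℕ.∸ a ≤ b → α ℕ.∸ b ≤ a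
      α∸-flip {a} {b} a≤α b≤α le = P.subst (α ℕ.∸ b ≤_) (ℕP.m∸[m∸n]≡n a≤α) (ℕP.∸-monoʳ-≤ α le)

      1≢2 : 1 ≢ 2
      1≢2 ()

      ΔU≢2-nonzero : ∀ i (vi : ValuationData i) → ΔU X i ≢ 2
      ΔU≢2-nonzero i vi e with g-dichotomy (α ℕ.∸ ValuationData.t vi) (ℕP.m∸n≤m α (ValuationData.t vi))
      ... | inj₁ (_ , g0') = ℕP.0≢1+n (P.trans (P.sym g0') (P.trans (P.sym (ValuationData.Δeq vi)) e))
      ... | inj₂ (_ , gc) = 1≢2 (P.trans (P.sym (P.trans (ValuationData.Δeq vi) (P.trans gc g-top≡1))) e)

      ΔU≢2 : ∀ i → ΔU X i ≢ 2
      ΔU≢2 i e with toℕ i ℕ.≟ 0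
      ... | yes z = ℕP.0≢1+n (P.trans (P.sym (ΔU-zero i z)) e)
      ... | no nz = ΔU≢2-nonzero i (valuationData i nz) e

      β≤α : β ≤ α
      β≤α = ℕP.<⇒≤ β<α

      ΔU-on-subgroup-nonzero : ∀ i (vi : ValuationData i) → p ℕ.^ (α ℕ.∸ β) ∣ toℕ i → ΔU X i ≡ 0
      ΔU-on-subgroup-nonzero i vi dv = P.trans (ValuationData.Δeq vi) (g≡0-upto-β (α ℕ.∸ ValuationData.t vi) (α∸-flip β≤α (ℕP.<⇒≤ (ValuationData.t<α vi)) le))
        where
        le : α ℕ.∸ β ≤ ValuationData.t vi
        le = p^e∣p^s*u⇒e≤s (ValuationData.¬p∣u vi) (α ℕ.∸ β) (ValuationData.t vi) (P.subst (p ℕ.^ (α ℕ.∸ β) ∣_) (ValuationData.teq vi) dv)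

      ΔU-on-subgroup : ∀ i → p ℕ.^ (α ℕ.∸ β) ∣ toℕ i → ΔU X i ≡ 0
      ΔU-on-subgroup i dv with toℕ i ℕ.≟ 0
      ... | yes z = ΔU-zero i z
      ... | no nz = ΔU-on-subgroup-nonzero i (valuationData i nz) dv

      ΔU-off-subgroup-nonzero : ∀ i (vi : ValuationData i) → ¬ (p ℕ.^ (α ℕ.∸ β) ∣ toℕ i) → ΔU X i ≡ 1
      ΔU-off-subgroup-nonzero i vi ndv with g-dichotomy (α ℕ.∸ ValuationData.t vi) (ℕP.m∸n≤m α (ValuationData.t vi))
      ... | inj₁ (le , _) = ⊥-elim (ndv (P.subst (p ℕ.^ (α ℕ.∸ β) ∣_) (P.sym (ValuationData.teq vi))
                               (e≤s⇒p^e∣p^s*u (ValuationData.u vi) (α ℕ.∸ β) (ValuationData.t vi) (α∸-flip (ℕP.<⇒≤ (ValuationData.t<α vi)) β≤α le))))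
      ... | inj₂ (_ , gc) = P.trans (ValuationData.Δeq vi) (P.trans gc g-top≡1)

      ΔU-off-subgroup : ∀ i → ¬ (p ℕ.^ (α ℕ.∸ β) ∣ toℕ i) → ΔU X i ≡ 1
      ΔU-off-subgroup i ndv with toℕ i ℕ.≟ 0
      ... | yes z = ⊥-elim (ndv (P.subst (p ℕ.^ (α ℕ.∸ β) ∣_) (P.sym z) (divides 0 P.refl)))
      ... | no nz = ΔU-off-subgroup-nonzero i (valuationData i nz) ndv


open import Defs
open import Level using (Level)
open import Data.Nat using (ℕ; _≤_; _^_; _∸_)
open import Data.Nat.Divisibility using (_∣_)
open import Data.Nat.Primality using (Prime)
open import Data.Fin using (Fin; toℕ)
open import Data.Fin.Subset using (Subset; outside)
open import Data.Vec using (lookup)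
open import Data.Sum using (_⊎_)
open import Data.Product using (_×_; _,_)
open import Relation.Nullary using (¬_)
open import Relation.Binary.PropositionalEquality using (_≡_; _≢_)
open import Algebra.Bundles using (CommutativeRing)

lemma3p3 : ∀ {c ℓ : Level} (R : CommutativeRing c ℓ) → Char0 R → NoZeroDivisors R →
    (p α : ℕ) → Prime p → p ≢ 2 → 1 ≤ α →
    (ζ : CommutativeRing.Carrier R) → PrimitiveRoot R p α ζ →
    (X : Subset (p ^ α)) →
    (∀ i → toℕ i ≡ 0 → lookup X i ≡ outside) →
    ¬ (∀ i → lookup X i ≡ lookup X (neg i)) →
    (m : ℕ) → 1 ≤ m →
    (∀ z → toℕ z ≢ 0 →
    CommutativeRing._≈_ R (FΔU R ζ X z) (CommutativeRing.0# R)
    ⊎ CommutativeRing._≈_ R (FΔU R ζ X z) (negConst R m)) →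
    (β : ℕ) → IsMinValOnΓ R p α ζ X m β →
    (∀ i → ΔU X i ≢ 2)
    × (∀ i → ((p ^ (α ∸ β)) ∣ toℕ i → ΔU X i ≡ 0)
    × (¬ ((p ^ (α ∸ β)) ∣ toℕ i) → ΔU X i ≡ 1))
lemma3p3 R char0 nzd p α pr p≢2 α≥1 ζ prim X 0∉X X≢-X m m≥1 FΔU∈0,negm β β-min =
  ΔU≢2 , λ i → ΔU-on-subgroup i , ΔU-off-subgroup i
  where
  open TransformAnalysis.Transform.Conclusion R char0 nzd p α pr α≥1 ζ prim X m m≥1 FΔU∈0,negm 0∉X X≢-X β β-min p≢2
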